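{- Let $G_0$, $G_1$ be order-$k$ de Bruijn graphs given by BOSS representations, with nodes $v_1,\dots,v_{n_0}$ of $G_0$ and $w_1,\dots,w_{n_1}$ of $G_1$ in colexicographic order. For every $h=2,\dots,k$, the bitvector $Z^{(h)}$ computed by the procedure described in the context satisfies: for all $i=1,\dots,n_0$ and $j=1,\dots,n_1$, the $i$-th $0$ precedes the $j$-th $1$ in $Z^{(h)}$ if and only if $\overleftarrow{v_i}[1,h]\preceq\overleftarrow{w_j}[1,h]$.
   Context: De Bruijn graph: strings over $\Sigma=\{1,\dots,\sigma\}$ padded with $k$ copies of $\$\notin\Sigma$ smaller than all symbols; one node per distinct $k$-mer $v[1,k]$; an edge $(u,v)$ labeled $v[k]$ iff some string contains $u[1,k]v[k]$. $\overleftarrow{v}=v[k]\cdots v[1]$ and $\preceq$ is the (non-strict) lexicographic order. BOSS representation of a graph with nodes $v_1,\dots,v_n$ ordered so that $\overleftarrow{v_1}\prec\cdots\prec\overleftarrow{v_n}$: $W=W_1\cdots W_n$ where $W_i$ is the sorted sequence of labels of edges leaving $v_i$ (or $\$$ if out-degree $0$); $W^-[i]=1$ iff $W[i]$ labels an edge $(u,v)$ with $u$ the smallest-ranked node with an edge to $v$; $\mathsf{last}[i]=1$ iff $i$ is the last position of some $W_j$. Let $\langle W_b,W_b^-,\mathsf{last}_b\rangle$ be the BOSS representation of $G_b$, $b\in\{0,1\}$. For $c\in\Sigma$ let $\ell_b(c)$ be the number of positions $i$ with $W_b^-[i]=1$ and $W_b[i]=c$, and $\mathsf{start}(c)=3+\sum_{c'<c}(\ell_0(c')+\ell_1(c'))$.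 Define $Z^{(1)}=0\,1\,0^{\ell_0(1)}1^{\ell_1(1)}0^{\ell_0(2)}1^{\ell_1(2)}\cdots0^{\ell_0(\sigma)}1^{\ell_1(\sigma)}$. For $h\ge2$, $Z^{(h)}$ (length $n_0+n_1$) is computed from $Z^{(h-1)}$ as follows: set $F[c]=\mathsf{start}(c)$ for all $c$, counters $i_0=i_1=1$, and $Z^{(h)}[1]=0$, $Z^{(h)}[2]=1$. For $p=1,\dots,n_0+n_1$: let $b=Z^{(h-1)}[p]$; repeat: if $W_b^-[i_b]=1$ then with $c=W_b[i_b]$ set $Z^{(h)}[F[c]]=b$ and increment $F[c]$; then increment $i_b$; stop repeating right after processing a position $i_b$ with $\mathsf{last}_b[i_b]=1$. -}

module Defs where

open import Data.Bool using (Bool; true; false; if_then_else_; not; _∧_)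
open import Data.Nat using (ℕ; zero; suc; _+_; _∸_; _<_; _≤_; _≡ᵇ_)
import Data.Nat.Properties as ℕₚ
open import Data.List using (List; []; _∷_; _++_; _∷ʳ_; map; filter; filterᵇ; length; replicate; reverse; take; drop; upTo; concat)
open import Data.Bool.ListAction using (any)
open import Data.Nat.ListAction using (sum)
open import Data.List.Relation.Unary.Any using (Any)
import Data.List.Relation.Unary.Any as Any
import Data.List.Properties as Lₚ
open import Data.List.Relation.Binary.Infix.Heterogeneous using (Infix)
open import Data.List.Relation.Binary.Infix.Heterogeneous.Properties using (infix?)
open import Data.List.Relation.Binary.Lex.Core using (Lex-<; Lex-≤)
open import Data.List.Relation.Unary.Linked using (Linked)
open import Data.List.Membership.Propositional using (_∈_)
open import Data.Product using (_×_; _,_; proj₁; proj₂; Σ)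
open import Function.Bundles using (_⇔_)
open import Relation.Binary.PropositionalEquality using (_≡_)
open import Relation.Nullary.Decidable using (⌊_⌋)

-- Symbols are natural numbers: 0 encodes $, and Σ = {1,…,σ}.

$ : ℕ
$ = 0

oneTo : ℕ → List ℕ
oneTo m = map suc (upTo m)

pad : ℕ → List ℕ → List ℕ
pad k s = replicate k $ ++ s

-- v is a node of the order-k de Bruijn graph of the string collection S:
-- a k-mer occurring (contiguously) in some padded string.
IsNode : ℕ → List (List ℕ) → List ℕ → Set
IsNode k S v = length v ≡ k × Any (λ s → Infix _≡_ v (pad k s)) S

-- There is an edge leaving node u labelled c (to node u[2,k]c):
-- some padded string contains u[1,k]c.  (Boolean / decided version.)
edgeᵇ : ℕ → List (List ℕ) → List ℕ → ℕ → Bool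
edgeᵇ k S u c = any (λ s → ⌊ infix? ℕₚ._≟_ (u ∷ʳ c) (pad k s) ⌋) S

_⪯_ : List ℕ → List ℕ → Set
xs ⪯ ys = Lex-≤ _≡_ _<_ xs ys

_≺_ : List ℕ → List ℕ → Set
xs ≺ ys = Lex-< _≡_ _<_ xs ys

_≺colex_ : List ℕ → List ℕ → Set
u ≺colex v = reverse u ≺ reverse v

NodeOrder : ℕ → List (List ℕ) → List (List ℕ) → Set
NodeOrder k S vs = (∀ v → (v ∈ vs) ⇔ IsNode k S v) × Linked _≺colex_ vs

-- BOSS representation.  An entry is a triple (W[i], W⁻[i], last[i]).

Entry : Set
Entry = ℕ × Bool × Bool

entW : Entry → ℕ
entW = proj₁

entW⁻ : Entry → Bool
entW⁻ e = proj₁ (proj₂ e)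

entLast : Entry → Bool
entLast e = proj₂ (proj₂ e)

outLabels : ℕ → ℕ → List (List ℕ) → List ℕ → List ℕ
outLabels σ k S v = filterᵇ (edgeᵇ k S v) (oneTo σ)

-- W⁻ bit for the edge leaving v labelled c, given the list of nodes
-- ranked before v: 1 iff no earlier node has an edge to the same
-- target v[2,k]c (an edge from u reaches v[2,k]c iff u[2,k] = v[2,k]
-- and the edge is labelled c).
minBit : ℕ → List (List ℕ) → List (List ℕ) → List ℕ → ℕ → Bool
minBit k S earlier v c =
  not (any (λ u → ⌊ Lₚ.≡-dec ℕₚ._≟_ (drop 1 u) (drop 1 v) ⌋ ∧ edgeᵇ k S u c) earlier)

markLast : List (ℕ × Bool) → List Entry
markLast [] = []
markLast ((c , m) ∷ []) = (c , m , true) ∷ []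
markLast ((c , m) ∷ x ∷ xs) = (c , m , false) ∷ markLast (x ∷ xs)

block : ℕ → ℕ → List (List ℕ) → List (List ℕ) → List ℕ → List Entry
block σ k S earlier v with outLabels σ k S v
... | [] = ($ , false , true) ∷ []
... | ls@(_ ∷ _) = markLast (map (λ c → c , minBit k S earlier v c) ls)

bossGo : ℕ → ℕ → List (List ℕ) → List (List ℕ) → List (List ℕ) → List Entry
bossGo σ k S earlier [] = []
bossGo σ k S earlier (v ∷ vs) = block σ k S earlier v ++ bossGo σ k S (earlier ∷ʳ v) vs

BOSS : ℕ → ℕ → List (List ℕ) → List (List ℕ) → List Entry
BOSS σ k S vs = bossGo σ k S [] vs

ℓ : List Entry → ℕ → ℕ
ℓ B c = length (filterᵇ (λ e → entW⁻ e ∧ (entW e ≡ᵇ c)) B)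

start : List Entry → List Entry → ℕ → ℕ
start B₀ B₁ c = 3 + sum (map (λ c' → ℓ B₀ c' + ℓ B₁ c') (oneTo (c ∸ 1)))

-- The bitvectors Z^{(h)}  (0 = false, 1 = true; positions are 1-based).

Z1 : ℕ → List Entry → List Entry → List Bool
Z1 σ B₀ B₁ = false ∷ true ∷ concat (map (λ c → replicate (ℓ B₀ c) false ++ replicate (ℓ B₁ c) true) (oneTo σ))

-- Z[p] := b  (1-based; out-of-range writes are ignored)
setAt : List Bool → ℕ → Bool → List Bool
setAt [] p b = []
setAt (x ∷ xs) zero b = x ∷ xs
setAt (x ∷ xs) (suc zero) b = b ∷ xs
setAt (x ∷ xs) (suc (suc p)) b = x ∷ setAt xs (suc p) b

State : Set
State = List Bool × (ℕ → ℕ)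

consume : Bool → List Entry → State → List Entry × State
consume b [] st = [] , st
consume b ((c , m , l) ∷ es) (Z , F) =
  let st' : State
      st' = if m then (setAt Z (F c) b , (λ x → if x ≡ᵇ c then suc (F x) else F x))
                 else (Z , F)
  in if l then (es , st') else consume b es st'

outer : List Bool → List Entry → List Entry → State → State
outer [] e₀ e₁ st = st
outer (false ∷ bs) e₀ e₁ st with consume false e₀ st
... | e₀' , st' = outer bs e₀' e₁ st'
outer (true ∷ bs) e₀ e₁ st with consume true e₁ st
... | e₁' , st' = outer bs e₀ e₁' st'

Zstep : ℕ → List Entry → List Entry → List Bool → List Bool
Zstep n B₀ B₁ Zprev =
  proj₁ (outer Zprev B₀ B₁ (setAt (setAt (replicate n false) 1 false) 2 true , start B₀ B₁))

-- Zh n B₀ B₁ h = Z^{(h)} for h ≥ 1 (n = n₀ + n₁); Z^{(0)} is unused.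
Zh : ℕ → ℕ → List Entry → List Entry → ℕ → List Bool
Zh σ n B₀ B₁ zero = []
Zh σ n B₀ B₁ (suc zero) = Z1 σ B₀ B₁
Zh σ n B₀ B₁ (suc (suc h)) = Zstep n B₀ B₁ (Zh σ n B₀ B₁ (suc h))

count : Bool → List Bool → ℕ
count true xs = length (filterᵇ (λ x → x) xs)
count false xs = length (filterᵇ not xs)

-- the r-th occurrence (0-based r) of b in Z is at (0-based) position p
Occ : List Bool → Bool → ℕ → ℕ → Set
Occ Z b r p = Σ (p < length Z) (λ _ → (take 1 (drop p Z) ≡ b ∷ []) × count b (take p Z) ≡ r)

-- the r-th 0 precedes the s-th 1 in Z (0-based r, s)
Precedes : List Bool → ℕ → ℕ → Set
Precedes Z r s = Σ ℕ λ p → Σ ℕ λ q → Occ Z false r p × Occ Z true s q × p < q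

OverΣ : ℕ → List ℕ → Set
OverΣ σ s = All (λ c → 1 ≤ c × c ≤ σ) s
  where open import Data.List.Relation.Unary.All using (All)

-- Tag the nodes of G₀ by 0 and those of G₁ by 1 and merge the two colex-sorted node lists by
-- their length-h keys (the first h symbols of the reversed node), ties going to G₀; the claim is
-- that Z^(h) is the bitvector of tags of this merge, after which the theorem is a property of
-- merges of sorted lists. Since every key starts with the last symbol of the node, such a merge is
-- the concatenation, over the last symbols $ < 1 < ⋯ < σ, of the merges of the nodes ending in
-- that symbol; the $-group is 0 1 (the node $ᵏ of both graphs). For h = 1 every group is
-- 0^ℓ₀(c) 1^ℓ₁(c), which is Z^(1). For the step h → h+1, the scan visits the blocks of both
-- graphs in the order given by Z^(h) and writes the tag of each W⁻-marked edge labelled c into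
-- bucket c. The W⁻-marked c-edges are exactly one per node ending in c (the edge from its
-- colex-smallest source), the map u ↦ u[2,k]c preserves the colex order of sources with distinct
-- u[2,k], and it turns the length-h key of u into c followed by it. Hence bucket c receives the
-- merge by length-(h+1) keys of the nodes ending in c, and the buckets together form Z^(h+1).

module Submission where

open import Defs

open import Data.Bool using (Bool; true; false; if_then_else_; not; _∧_; T)
open import Data.Bool.Properties using (T?; T-≡; T-∧; ∧-zeroʳ; ∧-identityʳ)
open import Data.Empty using (⊥; ⊥-elim)
open import Data.Fin using (Fin; toℕ) renaming (zero to fzero; suc to fsuc)
import Data.Fin.Properties as Finₚ
open import Data.List
  using (List; []; _∷_; _++_; _∷ʳ_; map; filter; filterᵇ; length; replicate; reverse; take; drop; head; lookup;
         concat; concatMap; foldl; upTo; applyUpTo; initLast; _∷ʳ′_)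
import Data.List.Properties as Lₚ
open Lₚ using (filter-accept; filter-reject; filter-none; filter-all)
open import Data.List.Membership.Propositional using (_∈_)
open import Data.List.Membership.Propositional.Properties using (∈-lookup; ∈-filter⁺; ∈-filter⁻)
open import Data.List.Relation.Binary.Infix.Heterogeneous using (Infix; MkView; toView; fromView)
open import Data.List.Relation.Binary.Lex.Core using (base; halt; this; next)
import Data.List.Relation.Binary.Lex.Strict as LexStrict
import Data.List.Relation.Binary.Pointwise as Pointwise
open import Data.List.Relation.Unary.All using (All; []; _∷_)
import Data.List.Relation.Unary.All as All
import Data.List.Relation.Unary.All.Properties as AllP
open import Data.List.Relation.Unary.AllPairs using (AllPairs; []; _∷_)
import Data.List.Relation.Unary.AllPairs as AllPairs
import Data.List.Relation.Unary.AllPairs.Properties as AllPairsP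
open import Data.List.Relation.Unary.Any using (Any; here; there)
import Data.List.Relation.Unary.Any as Any
open import Data.List.Relation.Unary.Any.Properties using (any⁺; any⁻)
open import Data.List.Relation.Unary.Linked.Properties using (Linked⇒AllPairs)
open import Data.Maybe using (fromMaybe)
open import Data.Nat using (ℕ; zero; suc; _+_; _∸_; _<_; _≤_; _≡ᵇ_; _≟_; _<?_; z≤n; s≤s; s≤s⁻¹)
open import Data.Nat.ListAction using (sum)
import Data.Nat.Properties as ℕₚ
open import Data.Product using (_×_; _,_; proj₁; proj₂; map₁; map₂; Σ; Σ-syntax)
open import Data.Sum using (inj₁; inj₂)
open import Data.Unit using (tt)
open import Function using (_∘_)
open import Function.Bundles using (_⇔_; mk⇔; Equivalence)
import Function.Properties.Equivalence as ⇔
open import Relation.Binary.Bundles using (DecTotalOrder; StrictPartialOrder)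
open import Relation.Binary.Definitions using (Decidable; Transitive; Total; Reflexive; tri<; tri≈; tri>)
open import Relation.Binary.PropositionalEquality
  using (_≡_; refl; sym; trans; cong; cong₂; subst; subst₂; _≢_; module ≡-Reasoning)
open import Relation.Nullary using (¬_; yes; no; does; contradiction)
open import Relation.Nullary.Decidable using (toWitness; fromWitness)
open import Relation.Unary using () renaming (Decidable to Decidable₁)

length-∷ʳ : {A : Set} (xs : List A) (x : A) → length (xs ∷ʳ x) ≡ suc (length xs)
length-∷ʳ xs x = trans (Lₚ.length-++ xs) (ℕₚ.+-comm (length xs) 1)

take-++ : {A : Set} (n : ℕ) (xs ys : List A) → n ≤ length xs → take n (xs ++ ys) ≡ take n xs
take-++ zero xs ys _ = refl
take-++ (suc n) (x ∷ xs) ys (s≤s n≤xs) = cong (x ∷_) (take-++ n xs ys n≤xs)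

++-prefix : {A : Set} (xs ys zs ws : List A) → length xs ≡ length zs → xs ++ ys ≡ zs ++ ws → xs ≡ zs
++-prefix [] ys [] ws _ _ = refl
++-prefix (x ∷ xs) ys (z ∷ zs) ws |xs|≡|zs| eq =
  cong₂ _∷_ (Lₚ.∷-injectiveˡ eq) (++-prefix xs ys zs ws (ℕₚ.suc-injective |xs|≡|zs|) (Lₚ.∷-injectiveʳ eq))

replicate-+ : {A : Set} (m n : ℕ) (x : A) → replicate (m + n) x ≡ replicate m x ++ replicate n x
replicate-+ zero n x = refl
replicate-+ (suc m) n x = cong (x ∷_) (replicate-+ m n x)

length-concat : {A : Set} (xss : List (List A)) → length (concat xss) ≡ sum (map length xss)
length-concat [] = refl
length-concat (xs ∷ xss) = trans (Lₚ.length-++ xs) (cong (length xs +_) (length-concat xss))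

concat-replicate : {A : Set} (f : ℕ → ℕ) (x : A) (cs : List ℕ) →
                   concat (map (λ c → replicate (f c) x) cs) ≡ replicate (sum (map f cs)) x
concat-replicate f x [] = refl
concat-replicate f x (c ∷ cs) =
  trans (cong (replicate (f c) x ++_) (concat-replicate f x cs)) (sym (replicate-+ (f c) _ x))

applyUpTo-+ : {A : Set} (f : ℕ → A) (m n : ℕ) →
              applyUpTo f (m + n) ≡ applyUpTo f m ++ applyUpTo (λ i → f (m + i)) n
applyUpTo-+ f zero n = refl
applyUpTo-+ f (suc m) n = cong (f 0 ∷_) (applyUpTo-+ (f ∘ suc) m n)

All-≡-replicate : ∀ {x : ℕ} v → All (_≡ x) v → v ≡ replicate (length v) x
All-≡-replicate [] [] = refl
All-≡-replicate (y ∷ v) (y≡x ∷ v≡x) = cong₂ _∷_ y≡x (All-≡-replicate v v≡x)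

filterᵇ-filterᵇ : {A : Set} (p q : A → Bool) (xs : List A) → filterᵇ p (filterᵇ q xs) ≡ filterᵇ (λ x → q x ∧ p x) xs
filterᵇ-filterᵇ p q [] = refl
filterᵇ-filterᵇ p q (x ∷ xs) with q x
... | false = filterᵇ-filterᵇ p q xs
... | true with p x
...   | true = cong (x ∷_) (filterᵇ-filterᵇ p q xs)
...   | false = filterᵇ-filterᵇ p q xs

≡⇒≡ᵇ≡true : ∀ {m n} → m ≡ n → (m ≡ᵇ n) ≡ true
≡⇒≡ᵇ≡true {m} refl = Equivalence.to T-≡ (ℕₚ.≡⇒≡ᵇ m m refl)

≢⇒≡ᵇ≡false : ∀ {m n} → m ≢ n → (m ≡ᵇ n) ≡ false
≢⇒≡ᵇ≡false {m} {n} m≢n with m ≡ᵇ n in eq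
... | true = contradiction (ℕₚ.≡ᵇ⇒≡ m n (Equivalence.from T-≡ eq)) m≢n
... | false = refl

T-not⁻ : ∀ {b} → T (not b) → ¬ T b
T-not⁻ {false} _ ()

T-not⁺ : ∀ {b} → ¬ T b → T (not b)
T-not⁺ {false} _ = tt
T-not⁺ {true} ¬t = ¬t tt

∈-tail : {A : Set} {x y : A} {xs : List A} → x ∈ y ∷ xs → x ≢ y → x ∈ xs
∈-tail (here x≡y) x≢y = contradiction x≡y x≢y
∈-tail (there x∈) _ = x∈

sorted-unique : {A : Set} {R : A → A → Set} → Transitive R → (∀ {x} → ¬ R x x) →
                ∀ {xs ys} → AllPairs R xs → AllPairs R ys →
                (∀ {z} → z ∈ xs → z ∈ ys) → (∀ {z} → z ∈ ys → z ∈ xs) → xs ≡ ys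
sorted-unique tr irr {[]} {[]} _ _ _ _ = refl
sorted-unique tr irr {[]} {y ∷ ys} _ _ _ ys⊆ with ys⊆ (here refl)
... | ()
sorted-unique tr irr {x ∷ xs} {[]} _ _ xs⊆ _ with xs⊆ (here refl)
... | ()
sorted-unique {R = R} tr irr {x ∷ xs} {y ∷ ys} (x<xs ∷ sxs) (y<ys ∷ sys) xs⊆ ys⊆ =
  cong₂ _∷_ x≡y (sorted-unique tr irr sxs sys xs⊆′ ys⊆′)
  where
  x≡y : x ≡ y
  x≡y with xs⊆ (here refl) | ys⊆ (here refl)
  ... | here x≡y | _ = x≡y
  ... | there _ | here y≡x = sym y≡x
  ... | there x∈ys | there y∈xs = contradiction (tr (All.lookup x<xs y∈xs) (All.lookup y<ys x∈ys)) irr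
  xs⊆′ : ∀ {z} → z ∈ xs → z ∈ ys
  xs⊆′ z∈xs with xs⊆ (there z∈xs)
  ... | here refl = contradiction (subst (R x) (sym x≡y) (All.lookup x<xs z∈xs)) irr
  ... | there z∈ys = z∈ys
  ys⊆′ : ∀ {z} → z ∈ ys → z ∈ xs
  ys⊆′ z∈ys with ys⊆ (there z∈ys)
  ... | here refl = contradiction (subst (R y) x≡y (All.lookup y<ys z∈ys)) irr
  ... | there z∈xs = z∈xs

infix-split : {A : Set} {z L : List A} → Infix _≡_ z L → Σ[ P ∈ List A ] Σ[ Q ∈ List A ] L ≡ P ++ z ++ Q
infix-split i with toView i
... | MkView P z≋w Q rewrite Pointwise.Pointwise-≡⇒≡ z≋w = P , Q , refl

split-infix : {A : Set} (P z Q : List A) → Infix _≡_ z (P ++ z ++ Q)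
split-infix P z Q = fromView (MkView P (Pointwise.≡⇒Pointwise-≡ refl) Q)

infix-All : {A : Set} {P : A → Set} {z L : List A} → Infix _≡_ z L → All P L → All P z
infix-All {z = z} i allL with infix-split i
... | P′ , Q , refl = AllP.++⁻ˡ z (AllP.++⁻ʳ P′ allL)

infix-++ˡ : {A : Set} {xs ys L : List A} → Infix _≡_ (xs ++ ys) L → Infix _≡_ xs L
infix-++ˡ {xs = xs} {ys} i with infix-split i
... | P , Q , refl rewrite Lₚ.++-assoc xs ys Q = split-infix P xs (ys ++ Q)

infix-tail : {A : Set} {a : A} {w L : List A} → Infix _≡_ (a ∷ w) L → Infix _≡_ w L
infix-tail {a = a} {w} i with infix-split i
... | P , Q , refl rewrite sym (Lₚ.++-assoc P (a ∷ []) (w ++ Q)) = split-infix (P ∷ʳ a) w Q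

InRange : ℕ → ℕ → Set
InRange σ c = 1 ≤ c × c ≤ σ

oneTo-range : ∀ σ → All (InRange σ) (oneTo σ)
oneTo-range σ = AllP.map⁺ (AllP.applyUpTo⁺₁ (λ i → i) σ (λ i<σ → s≤s z≤n , i<σ))

oneTo-split : ∀ {c σ} → 1 ≤ c → c ≤ σ →
              Σ[ rest ∈ List ℕ ] (oneTo σ ≡ oneTo (c ∸ 1) ++ c ∷ rest) × All (c <_) rest
oneTo-split {suc c} {σ} _ c<σ =
  rest , split ,
  AllP.applyUpTo⁺₂ _ d (λ i → s≤s (s≤s (ℕₚ.m≤m+n c i)))
  where
  open ≡-Reasoning
  d : ℕ
  d = σ ∸ suc c
  rest : List ℕ
  rest = applyUpTo (λ i → suc (suc c + i)) d
  split : oneTo σ ≡ oneTo c ++ suc c ∷ rest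
  split = begin
    oneTo σ                                                       ≡⟨ Lₚ.map-upTo suc σ ⟩
    applyUpTo suc σ                                               ≡⟨ cong (applyUpTo suc) (sym (ℕₚ.m+[n∸m]≡n c<σ)) ⟩
    applyUpTo suc (suc c + d)                                     ≡⟨ applyUpTo-+ suc (suc c) d ⟩
    applyUpTo suc (suc c) ++ rest                                 ≡⟨ cong (_++ rest) (sym (Lₚ.applyUpTo-∷ʳ suc c)) ⟩
    (applyUpTo suc c ∷ʳ suc c) ++ rest                            ≡⟨ Lₚ.++-assoc (applyUpTo suc c) _ _ ⟩
    applyUpTo suc c ++ suc c ∷ rest                               ≡⟨ cong (_++ suc c ∷ rest) (sym (Lₚ.map-upTo suc c)) ⟩
    oneTo c ++ suc c ∷ rest                                       ∎

length-filterᵇ-oneTo : ∀ (p : ℕ → Bool) {σ c} → InRange σ c → (∀ x → x ≢ c → p x ≡ false) →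
               length (filterᵇ p (oneTo σ)) ≡ (if p c then 1 else 0)
length-filterᵇ-oneTo p {σ} {suc c} (1≤c , c≤σ) p≢c with oneTo-split 1≤c c≤σ
... | rest , split , rest>c = begin
  length (filterᵇ p (oneTo σ))
    ≡⟨ cong (length ∘ filterᵇ p) split ⟩
  length (filterᵇ p (oneTo c ++ suc c ∷ rest))
    ≡⟨ cong length (Lₚ.filter-++ (T? ∘ p) (oneTo c) (suc c ∷ rest)) ⟩
  length (filterᵇ p (oneTo c) ++ filterᵇ p (suc c ∷ rest))
    ≡⟨ cong (λ xs → length (xs ++ filterᵇ p (suc c ∷ rest))) (filter-none (T? ∘ p) pre-rejected) ⟩
  length (filterᵇ p (suc c ∷ rest))
    ≡⟨ single ⟩
  (if p (suc c) then 1 else 0) ∎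
  where
  open ≡-Reasoning
  rejected : ∀ {x} → x ≢ suc c → ¬ T (p x)
  rejected {x} x≢c px = subst T (p≢c x x≢c) px
  pre-rejected : All (¬_ ∘ T ∘ p) (oneTo c)
  pre-rejected = All.map (λ (_ , x≤c) → rejected (ℕₚ.<⇒≢ (s≤s x≤c))) (oneTo-range c)
  rest-empty : filterᵇ p rest ≡ []
  rest-empty = filter-none (T? ∘ p) (All.map (rejected ∘ ℕₚ.>⇒≢) rest>c)
  single : length (filterᵇ p (suc c ∷ rest)) ≡ (if p (suc c) then 1 else 0)
  single with p (suc c)
  ... | true = cong (suc ∘ length) rest-empty
  ... | false = cong length rest-empty

private module Lex≤ = DecTotalOrder (LexStrict.≤-decTotalOrder ℕₚ.<-strictTotalOrder)

_⪯?_ : Decidable _⪯_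
_⪯?_ = Lex≤._≤?_

⪯-refl : Reflexive _⪯_
⪯-refl = Lex≤.refl

⪯-trans : Transitive _⪯_
⪯-trans = Lex≤.trans

⪯-total : Total _⪯_
⪯-total = Lex≤.total

⋠⇒⪰ : ∀ {a b} → ¬ a ⪯ b → b ⪯ a
⋠⇒⪰ {a} {b} a⋠b with ⪯-total a b
... | inj₁ a⪯b = contradiction a⪯b a⋠b
... | inj₂ b⪯a = b⪯a

∷-⪯⁻ : ∀ {c a b} → (c ∷ a) ⪯ (c ∷ b) → a ⪯ b
∷-⪯⁻ (this c<c) = contradiction c<c (ℕₚ.<-irrefl refl)
∷-⪯⁻ (next _ a⪯b) = a⪯b

head-⪯ : ∀ {x y a b} → (x ∷ a) ⪯ (y ∷ b) → x ≤ y
head-⪯ (this x<y) = ℕₚ.<⇒≤ x<y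
head-⪯ (next refl _) = ℕₚ.≤-refl

private module Lex< = StrictPartialOrder (LexStrict.<-strictPartialOrder ℕₚ.<-strictPartialOrder)

≺-trans : Transitive _≺_
≺-trans = Lex<.trans

≺-irrefl : ∀ {xs} → ¬ xs ≺ xs
≺-irrefl = Lex<.irrefl (Pointwise.refl refl)

take-⪯ : ∀ h {xs ys} → xs ≺ ys → take h xs ⪯ take h ys
take-⪯ zero _ = base tt
take-⪯ (suc h) halt = halt
take-⪯ (suc h) (this x<y) = this x<y
take-⪯ (suc h) (next x≡y xs≺ys) = next x≡y (take-⪯ h xs≺ys)

≺-∷ʳ⁻ : ∀ (X Y : List ℕ) a b → length X ≡ length Y → X ≢ Y → (X ∷ʳ a) ≺ (Y ∷ʳ b) → X ≺ Y
≺-∷ʳ⁻ [] [] a b _ X≢Y _ = contradiction refl X≢Y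
≺-∷ʳ⁻ (x ∷ X) (y ∷ Y) a b _ _ (this x<y) = this x<y
≺-∷ʳ⁻ (x ∷ X) (.x ∷ Y) a b |X|≡|Y| X≢Y (next refl X≺Y) =
  next refl (≺-∷ʳ⁻ X Y a b (ℕₚ.suc-injective |X|≡|Y|) (X≢Y ∘ cong (x ∷_)) X≺Y)

-- Merging two lists by key

bits : {A : Set} → List (Bool × A) → List Bool
bits = map proj₁

lefts rights : {A : Set} → List (Bool × A) → List A
lefts M = map proj₂ (filterᵇ (not ∘ proj₁) M)
rights M = map proj₂ (filterᵇ proj₁ M)

Sorted : {A : Set} → (A → List ℕ) → List A → Set
Sorted κ = AllPairs (λ a b → κ a ⪯ κ b)

module _ {A : Set} (κ : A → List ℕ) where

  merge : List A → List A → List (Bool × A)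
  merge [] [] = []
  merge [] (y ∷ ys) = (true , y) ∷ merge [] ys
  merge (x ∷ xs) [] = (false , x) ∷ merge xs []
  merge (x ∷ xs) (y ∷ ys) =
    if does (κ x ⪯? κ y) then (false , x) ∷ merge xs (y ∷ ys) else (true , y) ∷ merge (x ∷ xs) ys

  length-merge : ∀ xs ys → length (merge xs ys) ≡ length xs + length ys
  length-merge [] [] = refl
  length-merge [] (y ∷ ys) = cong suc (length-merge [] ys)
  length-merge (x ∷ xs) [] = cong suc (length-merge xs [])
  length-merge (x ∷ xs) (y ∷ ys)
    with κ x ⪯? κ y | length-merge xs (y ∷ ys) | length-merge (x ∷ xs) ys
  ... | yes _ | rec | _ = cong suc rec
  ... | no _ | _ | rec = trans (cong suc rec) (sym (ℕₚ.+-suc (suc (length xs)) (length ys)))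

  count-true-merge : ∀ xs ys → count true (bits (merge xs ys)) ≡ length ys
  count-true-merge [] [] = refl
  count-true-merge [] (y ∷ ys) = cong suc (count-true-merge [] ys)
  count-true-merge (x ∷ xs) [] = count-true-merge xs []
  count-true-merge (x ∷ xs) (y ∷ ys)
    with κ x ⪯? κ y | count-true-merge xs (y ∷ ys) | count-true-merge (x ∷ xs) ys
  ... | yes _ | rec | _ = rec
  ... | no _ | _ | rec = cong suc rec

  All-merge : ∀ {P : A → Set} {xs ys} → All P xs → All P ys → All (P ∘ proj₂) (merge xs ys)
  All-merge {xs = []} {[]} [] [] = []
  All-merge {xs = []} {y ∷ ys} [] (py ∷ pys) = py ∷ All-merge [] pys
  All-merge {xs = x ∷ xs} {[]} (px ∷ pxs) [] = px ∷ All-merge pxs []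
  All-merge {xs = x ∷ xs} {y ∷ ys} (px ∷ pxs) (py ∷ pys)
    with κ x ⪯? κ y | All-merge pxs (py ∷ pys) | All-merge (px ∷ pxs) pys
  ... | yes _ | rec | _ = px ∷ rec
  ... | no _ | _ | rec = py ∷ rec

  merge-sorted : ∀ {xs ys} → Sorted κ xs → Sorted κ ys → Sorted (κ ∘ proj₂) (merge xs ys)
  merge-sorted {[]} {[]} [] [] = []
  merge-sorted {[]} {y ∷ ys} [] (y⪯ys ∷ sys) = All-merge [] y⪯ys ∷ merge-sorted [] sys
  merge-sorted {x ∷ xs} {[]} (x⪯xs ∷ sxs) [] = All-merge x⪯xs [] ∷ merge-sorted sxs []
  merge-sorted {x ∷ xs} {y ∷ ys} sx@(x⪯xs ∷ sxs) sy@(y⪯ys ∷ sys)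
    with κ x ⪯? κ y | merge-sorted sxs sy | merge-sorted sx sys
  ... | yes x⪯y | rec | _ = All-merge x⪯xs (x⪯y ∷ All.map (⪯-trans x⪯y) y⪯ys) ∷ rec
  ... | no x⋠y | _ | rec = All-merge (⋠⇒⪰ x⋠y ∷ All.map (⪯-trans (⋠⇒⪰ x⋠y)) x⪯xs) y⪯ys ∷ rec

  merge-headˡ : ∀ {x} xs {ys} → All (λ y → κ x ⪯ κ y) ys → merge (x ∷ xs) ys ≡ (false , x) ∷ merge xs ys
  merge-headˡ xs [] = refl
  merge-headˡ {x} xs {y ∷ _} (x⪯y ∷ _) with κ x ⪯? κ y
  ... | yes _ = refl
  ... | no x⋠y = contradiction x⪯y x⋠y

  merge-headʳ : ∀ {y} xs ys → All (λ x → ¬ κ x ⪯ κ y) xs → merge xs (y ∷ ys) ≡ (true , y) ∷ merge xs ys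
  merge-headʳ [] ys [] = refl
  merge-headʳ {y} (x ∷ _) ys (x⋠y ∷ _) with κ x ⪯? κ y
  ... | yes x⪯y = contradiction x⪯y x⋠y
  ... | no _ = refl

  merge-filter : ∀ {P : A → Set} (P? : Decidable₁ P) {xs ys} → Sorted κ xs → Sorted κ ys →
                 merge (filter P? xs) (filter P? ys) ≡ filter (P? ∘ proj₂) (merge xs ys)
  merge-filter P? {[]} {[]} [] [] = refl
  merge-filter P? {[]} {y ∷ ys} [] (_ ∷ sys) with does (P? y)
  ... | true = cong ((true , y) ∷_) (merge-filter P? [] sys)
  ... | false = merge-filter P? [] sys
  merge-filter P? {x ∷ xs} {[]} (_ ∷ sxs) [] with does (P? x)
  ... | true = cong ((false , x) ∷_) (merge-filter P? sxs [])
  ... | false = merge-filter P? sxs []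
  merge-filter P? {x ∷ xs} {y ∷ ys} sx@(x⪯xs ∷ sxs) sy@(y⪯ys ∷ sys)
    with κ x ⪯? κ y | merge-filter P? sxs sy | merge-filter P? sx sys
  ... | yes x⪯y | rec | _ with does (P? x)
  ...   | true = trans (merge-headˡ (filter P? xs) (AllP.filter⁺ P? (x⪯y ∷ All.map (⪯-trans x⪯y) y⪯ys)))
                     (cong ((false , x) ∷_) rec)
  ...   | false = rec
  merge-filter P? {x ∷ xs} {y ∷ ys} sx@(x⪯xs ∷ sxs) sy@(y⪯ys ∷ sys) | no x⋠y | _ | rec with does (P? y)
  ...   | true = trans (merge-headʳ (filter P? (x ∷ xs)) (filter P? ys)
                         (AllP.filter⁺ P? (x⋠y ∷ All.map (λ x⪯z z⪯y → x⋠y (⪯-trans x⪯z z⪯y)) x⪯xs)))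
                     (cong ((true , y) ∷_) rec)
  ...   | false = rec

  merge-const : ∀ {K xs ys} → All (λ a → κ a ≡ K) xs → All (λ a → κ a ≡ K) ys →
                bits (merge xs ys) ≡ replicate (length xs) false ++ replicate (length ys) true
  merge-const {xs = []} {[]} [] [] = refl
  merge-const {xs = []} {y ∷ ys} [] (_ ∷ eys) = cong (true ∷_) (merge-const [] eys)
  merge-const {xs = x ∷ xs} {[]} (_ ∷ exs) [] = cong (false ∷_) (merge-const exs [])
  merge-const {xs = x ∷ xs} {y ∷ ys} (ex ∷ exs) ey∷eys@(ey ∷ _) with κ x ⪯? κ y
  ... | yes _ = cong (false ∷_) (merge-const exs ey∷eys)
  ... | no x⋠y = contradiction (subst₂ _⪯_ (sym ex) (sym ey) ⪯-refl) x⋠y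

  lefts-merge : ∀ xs ys → lefts (merge xs ys) ≡ xs
  lefts-merge [] [] = refl
  lefts-merge [] (y ∷ ys) = lefts-merge [] ys
  lefts-merge (x ∷ xs) [] = cong (x ∷_) (lefts-merge xs [])
  lefts-merge (x ∷ xs) (y ∷ ys)
    with κ x ⪯? κ y | lefts-merge xs (y ∷ ys) | lefts-merge (x ∷ xs) ys
  ... | yes _ | rec | _ = cong (x ∷_) rec
  ... | no _ | _ | rec = rec

  rights-merge : ∀ xs ys → rights (merge xs ys) ≡ ys
  rights-merge [] [] = refl
  rights-merge [] (y ∷ ys) = cong (y ∷_) (rights-merge [] ys)
  rights-merge (x ∷ xs) [] = rights-merge xs []
  rights-merge (x ∷ xs) (y ∷ ys)
    with κ x ⪯? κ y | rights-merge xs (y ∷ ys) | rights-merge (x ∷ xs) ys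
  ... | yes _ | rec | _ = rec
  ... | no _ | _ | rec = cong (y ∷_) rec

merge-map : {A B : Set} (κ : B → List ℕ) (f : A → B) (xs ys : List A) →
            merge κ (map f xs) (map f ys) ≡ map (map₂ f) (merge (κ ∘ f) xs ys)
merge-map κ f [] [] = refl
merge-map κ f [] (y ∷ ys) = cong ((true , f y) ∷_) (merge-map κ f [] ys)
merge-map κ f (x ∷ xs) [] = cong ((false , f x) ∷_) (merge-map κ f xs [])
merge-map κ f (x ∷ xs) (y ∷ ys)
  with κ (f x) ⪯? κ (f y) | merge-map κ f xs (y ∷ ys) | merge-map κ f (x ∷ xs) ys
... | yes _ | rec | _ = cong ((false , f x) ∷_) rec
... | no _ | _ | rec = cong ((true , f y) ∷_) rec

bits-map₂ : {A B : Set} (f : A → B) (M : List (Bool × A)) → bits (map (map₂ f) M) ≡ bits M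
bits-map₂ f M = sym (Lₚ.map-∘ M)

merge-∷-keys : {A : Set} (κ κ′ : A → List ℕ) (c : ℕ) → ∀ {xs ys} →
               All (λ a → κ′ a ≡ c ∷ κ a) xs → All (λ a → κ′ a ≡ c ∷ κ a) ys →
               merge κ′ xs ys ≡ merge κ xs ys
merge-∷-keys κ κ′ c {[]} {[]} [] [] = refl
merge-∷-keys κ κ′ c {[]} {y ∷ ys} [] (_ ∷ eys) = cong ((true , y) ∷_) (merge-∷-keys κ κ′ c [] eys)
merge-∷-keys κ κ′ c {x ∷ xs} {[]} (_ ∷ exs) [] = cong ((false , x) ∷_) (merge-∷-keys κ κ′ c exs [])
merge-∷-keys κ κ′ c {x ∷ xs} {y ∷ ys} ex∷exs@(ex ∷ exs) ey∷eys@(ey ∷ eys)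
  with κ′ x ⪯? κ′ y | κ x ⪯? κ y
     | merge-∷-keys κ κ′ c exs ey∷eys | merge-∷-keys κ κ′ c ex∷exs eys
... | yes _ | yes _ | rec | _ = cong ((false , x) ∷_) rec
... | no _ | no _ | _ | rec = cong ((true , y) ∷_) rec
... | yes x⪯′y | no x⋠y | _ | _ = contradiction (∷-⪯⁻ (subst₂ _⪯_ ex ey x⪯′y)) x⋠y
... | no x⋠′y | yes x⪯y | _ | _ = contradiction (subst₂ _⪯_ (sym ex) (sym ey) (next refl x⪯y)) x⋠′y

true-occurrence : ∀ Z s → s < count true Z → Σ ℕ (Occ Z true s)
true-occurrence (true ∷ Z) zero _ = 0 , s≤s z≤n , refl , refl
true-occurrence (true ∷ Z) (suc s) (s≤s s<n) with true-occurrence Z s s<n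
... | q , q<n , bit , cnt = suc q , s≤s q<n , bit , cong suc cnt
true-occurrence (false ∷ Z) s s<n with true-occurrence Z s s<n
... | q , q<n , bit , cnt = suc q , s≤s q<n , bit , cnt

precedes-false-zero : ∀ Z s → Σ ℕ (Occ Z true s) → Precedes (false ∷ Z) 0 s
precedes-false-zero Z s (q , q<n , bit , cnt) = 0 , suc q , (s≤s z≤n , refl , refl) , (s≤s q<n , bit , cnt) , s≤s z≤n

precedes-false-suc : ∀ Z r s → Precedes (false ∷ Z) (suc r) s ⇔ Precedes Z r s
precedes-false-suc Z r s = mk⇔ to from
  where
  to : Precedes (false ∷ Z) (suc r) s → Precedes Z r s
  to (zero , _ , (_ , _ , ()) , _ , _)
  to (suc p , zero , _ , (_ , () , _) , _)
  to (suc p , suc q , (s≤s p<n , bp , cp) , (s≤s q<n , bq , cq) , s≤s p<q) =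
    p , q , (p<n , bp , ℕₚ.suc-injective cp) , (q<n , bq , cq) , p<q
  from : Precedes Z r s → Precedes (false ∷ Z) (suc r) s
  from (p , q , (p<n , bp , cp) , (q<n , bq , cq) , p<q) =
    suc p , suc q , (s≤s p<n , bp , cong suc cp) , (s≤s q<n , bq , cq) , s≤s p<q

precedes-true-suc : ∀ Z r s → Precedes (true ∷ Z) r (suc s) ⇔ Precedes Z r s
precedes-true-suc Z r s = mk⇔ to from
  where
  to : Precedes (true ∷ Z) r (suc s) → Precedes Z r s
  to (zero , _ , (_ , () , _) , _ , _)
  to (suc p , zero , _ , (_ , _ , ()) , _)
  to (suc p , suc q , (s≤s p<n , bp , cp) , (s≤s q<n , bq , cq) , s≤s p<q) =
    p , q , (p<n , bp , cp) , (q<n , bq , ℕₚ.suc-injective cq) , p<q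
  from : Precedes Z r s → Precedes (true ∷ Z) r (suc s)
  from (p , q , (p<n , bp , cp) , (q<n , bq , cq) , p<q) =
    suc p , suc q , (s≤s p<n , bp , cp) , (s≤s q<n , bq , cong suc cq) , s≤s p<q

¬precedes-true-zero : ∀ Z r → ¬ Precedes (true ∷ Z) r 0
¬precedes-true-zero Z r (p , zero , _ , _ , ())
¬precedes-true-zero Z r (p , suc q , _ , (_ , _ , ()) , _)

merge-precedes : {A : Set} (κ : A → List ℕ) → ∀ {xs ys} → Sorted κ xs → Sorted κ ys →
                 (i : Fin (length xs)) (j : Fin (length ys)) →
                 Precedes (bits (merge κ xs ys)) (toℕ i) (toℕ j) ⇔ κ (lookup xs i) ⪯ κ (lookup ys j)
merge-precedes κ {x ∷ xs} {y ∷ ys} sx@(x⪯xs ∷ sxs) sy@(y⪯ys ∷ sys)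
  with κ x ⪯? κ y | merge-precedes κ sxs sy | merge-precedes κ sx sys
... | yes x⪯y | rec | _ = λ
  { fzero j → mk⇔ (λ _ → All.lookup (x⪯y ∷ All.map (⪯-trans x⪯y) y⪯ys) (∈-lookup j))
                  (λ _ → precedes-false-zero _ (toℕ j) (true-occurrence _ (toℕ j)
                           (subst (toℕ j <_) (sym (count-true-merge κ xs (y ∷ ys))) (Finₚ.toℕ<n j))))
  ; (fsuc i) j → ⇔.trans (precedes-false-suc _ (toℕ i) (toℕ j)) (rec i j) }
... | no x⋠y | _ | rec = λ
  { i fzero → mk⇔ (⊥-elim ∘ ¬precedes-true-zero _ (toℕ i))
                  (λ xᵢ⪯y → ⊥-elim (x⋠y (⪯-trans (All.lookup (⪯-refl ∷ x⪯xs) (∈-lookup i)) xᵢ⪯y)))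
  ; i (fsuc j) → ⇔.trans (precedes-true-suc _ (toℕ i) (toℕ j)) (rec i j) }

merge-singletons : {A : Set} (κ : A → List ℕ) (x : A) → bits (merge κ (x ∷ []) (x ∷ [])) ≡ false ∷ true ∷ []
merge-singletons κ x with κ x ⪯? κ x
... | yes _ = refl
... | no x⋠x = contradiction ⪯-refl x⋠x

-- Fibres of a sorted list

module _ {A : Set} (f : A → ℕ) where

  fibre : ℕ → List A → List A
  fibre c = filter (λ x → f x ≟ c)

  below : ℕ → List A → List A
  below m = filter (λ x → f x <? m)

  below-suc : ∀ m {xs} → AllPairs (λ x y → f x ≤ f y) xs → below (suc m) xs ≡ below m xs ++ fibre m xs
  below-suc m {[]} [] = refl
  below-suc m {x ∷ xs} (x≤xs ∷ sxs) with ℕₚ.<-cmp (f x) m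
  ... | tri< fx<m fx≢m _ =
    trans (filter-accept (λ y → f y <? suc m) (ℕₚ.m<n⇒m<1+n fx<m))
      (trans (cong (x ∷_) (below-suc m sxs))
        (cong₂ _++_ (sym (filter-accept (λ y → f y <? m) fx<m)) (sym (filter-reject (λ y → f y ≟ m) fx≢m))))
  ... | tri≈ fx≮m refl _ =
    trans (filter-accept (λ y → f y <? suc m) ℕₚ.≤-refl)
      (trans (cong (x ∷_) (trans (below-suc m sxs) (cong (_++ fibre m xs) (filter-none (λ y → f y <? m) xs≮m))))
        (cong₂ _++_ (sym (trans (filter-reject (λ y → f y <? m) fx≮m) (filter-none (λ y → f y <? m) xs≮m)))
                    (sym (filter-accept (λ y → f y ≟ m) refl))))
    where
    xs≮m : All (λ y → ¬ f y < f x) xs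
    xs≮m = All.map ℕₚ.≤⇒≯ x≤xs
  ... | tri> _ fx≢m m<fx =
    trans (filter-reject (λ y → f y <? suc m) (ℕₚ.<⇒≱ m<fx ∘ s≤s⁻¹))
      (trans (below-suc m sxs)
        (cong₂ _++_ (sym (filter-reject (λ y → f y <? m) (ℕₚ.<⇒≯ m<fx))) (sym (filter-reject (λ y → f y ≟ m) fx≢m))))

  below-fibres : ∀ m {xs} → AllPairs (λ x y → f x ≤ f y) xs → below m xs ≡ concat (map (λ c → fibre c xs) (upTo m))
  below-fibres zero {xs} _ = filter-none (λ y → f y <? 0) (All.universal (λ _ ()) xs)
  below-fibres (suc m) {xs} sxs = begin
    below (suc m) xs                                       ≡⟨ below-suc m sxs ⟩
    below m xs ++ fibre m xs                               ≡⟨ cong (_++ fibre m xs) (below-fibres m sxs) ⟩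
    concat (map fib (upTo m)) ++ fibre m xs                ≡⟨ cong (concat (map fib (upTo m)) ++_) (sym (Lₚ.++-identityʳ _)) ⟩
    concat (map fib (upTo m)) ++ concat (map fib (m ∷ [])) ≡⟨ Lₚ.concat-++ (map fib (upTo m)) _ ⟩
    concat (map fib (upTo m) ++ map fib (m ∷ []))          ≡⟨ cong concat (sym (Lₚ.map-++ fib (upTo m) _)) ⟩
    concat (map fib (upTo m ∷ʳ m))                         ≡⟨ cong (concat ∘ map fib) (Lₚ.upTo-∷ʳ m) ⟩
    concat (map fib (upTo (suc m)))                        ∎
    where
    open ≡-Reasoning
    fib : ℕ → List A
    fib c = fibre c xs

  concat-fibres : ∀ σ {xs} → AllPairs (λ x y → f x ≤ f y) xs → All (λ x → f x ≤ σ) xs →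
           xs ≡ concat (map (λ c → fibre c xs) (upTo (suc σ)))
  concat-fibres σ sxs xs≤σ = trans (sym (filter-all (λ y → f y <? suc σ) (All.map s≤s xs≤σ))) (below-fibres (suc σ) sxs)

HeadedBy : {A : Set} → (A → List ℕ) → (A → ℕ) → A → Set
HeadedBy κ f a = Σ[ t ∈ List ℕ ] κ a ≡ f a ∷ t

headed-sorted : {A : Set} (κ : A → List ℕ) (f : A → ℕ) → ∀ {xs} → All (HeadedBy κ f) xs → Sorted κ xs →
                AllPairs (λ a b → f a ≤ f b) xs
headed-sorted κ f [] [] = []
headed-sorted κ f ((t , κa) ∷ hs) (a⪯xs ∷ sxs) =
  All.zipWith (λ (a⪯b , (t′ , κb)) → head-⪯ (subst₂ _⪯_ κa κb a⪯b)) (a⪯xs , hs) ∷ headed-sorted κ f hs sxs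

merge-fibres : {A : Set} (κ : A → List ℕ) (f : A → ℕ) (σ : ℕ) → ∀ {xs ys} → Sorted κ xs → Sorted κ ys →
               All (HeadedBy κ f) xs → All (HeadedBy κ f) ys → All (λ a → f a ≤ σ) xs → All (λ a → f a ≤ σ) ys →
               bits (merge κ xs ys) ≡ concat (map (λ c → bits (merge κ (fibre f c xs) (fibre f c ys))) (upTo (suc σ)))
merge-fibres {A} κ f σ {xs} {ys} sxs sys hxs hys xs≤σ ys≤σ = begin
  bits M
    ≡⟨ cong bits (concat-fibres (f ∘ proj₂) σ sorted-f (All-merge κ xs≤σ ys≤σ)) ⟩
  bits (concat (map (λ c → fibre (f ∘ proj₂) c M) cs))
    ≡⟨ sym (Lₚ.concat-map (map (λ c → fibre (f ∘ proj₂) c M) cs)) ⟩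
  concat (map bits (map (λ c → fibre (f ∘ proj₂) c M) cs))
    ≡⟨ cong concat (sym (Lₚ.map-∘ cs)) ⟩
  concat (map (λ c → bits (fibre (f ∘ proj₂) c M)) cs)
    ≡⟨ cong concat (Lₚ.map-cong (λ c → cong bits (sym (merge-filter κ (λ x → f x ≟ c) sxs sys))) cs) ⟩
  concat (map (λ c → bits (merge κ (fibre f c xs) (fibre f c ys))) cs) ∎
  where
  open ≡-Reasoning
  M : List (Bool × A)
  M = merge κ xs ys
  cs : List ℕ
  cs = upTo (suc σ)
  sorted-f : AllPairs (λ p q → f (proj₂ p) ≤ f (proj₂ q)) M
  sorted-f = headed-sorted (κ ∘ proj₂) (f ∘ proj₂) (All-merge κ hxs hys) (merge-sorted κ sxs sys)

-- Keys of de Bruijn nodes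

key : ℕ → List ℕ → List ℕ
key h v = take h (reverse v)

lastSym : List ℕ → ℕ
lastSym v = fromMaybe 0 (head (reverse v))

target : ℕ → List ℕ → List ℕ
target c u = drop 1 u ∷ʳ c

key-headed : ∀ h v → 1 ≤ length v → HeadedBy (key (suc h)) lastSym v
key-headed h v 1≤v with reverse v | Lₚ.length-reverse v
... | [] | 0≡v = contradiction 0≡v (ℕₚ.<⇒≢ 1≤v)
... | x ∷ r | _ = take h r , refl

key-one : ∀ v → 1 ≤ length v → key 1 v ≡ lastSym v ∷ []
key-one v 1≤v with reverse v | Lₚ.length-reverse v
... | [] | 0≡v = contradiction 0≡v (ℕₚ.<⇒≢ 1≤v)
... | x ∷ r | _ = refl

key-target : ∀ h c u → h < length u → key (suc h) (target c u) ≡ c ∷ key h u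
key-target h c (a ∷ u) (s≤s h≤u) rewrite Lₚ.reverse-++ u (c ∷ []) | Lₚ.unfold-reverse a u =
  cong (c ∷_) (sym (take-++ h (reverse u) (a ∷ []) (subst (h ≤_) (sym (Lₚ.length-reverse u)) h≤u)))

lastSym-∷ʳ : ∀ zs x → lastSym (zs ∷ʳ x) ≡ x
lastSym-∷ʳ zs x rewrite Lₚ.reverse-++ zs (x ∷ []) = refl

lastSym-All : ∀ {P : ℕ → Set} v → All P v → P 0 → P (lastSym v)
lastSym-All {P} v allv p0 with initLast v
... | [] = p0
... | zs ∷ʳ′ x with AllP.++⁻ʳ zs allv
...   | px ∷ [] = subst P (sym (lastSym-∷ʳ zs x)) px

target-colex : ∀ c v u → length v ≡ length u → drop 1 v ≢ drop 1 u → v ≺colex u → target c v ≺colex target c u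
target-colex c [] [] _ ≢ _ = contradiction refl ≢
target-colex c (a ∷ v) (b ∷ u) |v|≡|u| v≢u v≺u
  rewrite Lₚ.reverse-++ v (c ∷ []) | Lₚ.reverse-++ u (c ∷ []) | Lₚ.unfold-reverse a v | Lₚ.unfold-reverse b u =
  next refl (≺-∷ʳ⁻ (reverse v) (reverse u) a b
              (trans (Lₚ.length-reverse v) (trans (ℕₚ.suc-injective |v|≡|u|) (sym (Lₚ.length-reverse u))))
              (v≢u ∘ Lₚ.reverse-injective) v≺u)

-- Filling buckets

setAt-++ʳ : ∀ (A B : List Bool) p b → setAt (A ++ B) (length A + suc p) b ≡ A ++ setAt B (suc p) b
setAt-++ʳ [] B p b = refl
setAt-++ʳ (x ∷ []) B p b = refl
setAt-++ʳ (x ∷ y ∷ A) B p b = cong (x ∷_) (setAt-++ʳ (y ∷ A) B p b)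

setAt-++ˡ : ∀ (A B : List Bool) p b → p < length A → setAt (A ++ B) (suc p) b ≡ setAt A (suc p) b ++ B
setAt-++ˡ (x ∷ A) B zero b _ = refl
setAt-++ˡ (x ∷ A) B (suc p) b (s≤s p<n) = cong (x ∷_) (setAt-++ˡ A B p b p<n)

fillTo : ℕ → List Bool → List Bool
fillTo n xs = xs ++ replicate (n ∸ length xs) false

length-fillTo : ∀ n xs → length xs ≤ n → length (fillTo n xs) ≡ n
length-fillTo n xs xs≤n =
  trans (Lₚ.length-++ xs) (trans (cong (length xs +_) (Lₚ.length-replicate (n ∸ length xs))) (ℕₚ.m+[n∸m]≡n xs≤n))

setAt-fillTo : ∀ n xs b → length xs < n → setAt (fillTo n xs) (suc (length xs)) b ≡ fillTo n (xs ∷ʳ b)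
setAt-fillTo (suc n) [] b _ = refl
setAt-fillTo (suc n) (x ∷ xs) b (s≤s xs<n) = cong (x ∷_) (setAt-fillTo n xs b xs<n)

setAt-concat : ∀ (pre : List (List Bool)) s post r b → r < length s →
               setAt (concat (pre ++ s ∷ post)) (length (concat pre) + suc r) b ≡
               concat (pre ++ setAt s (suc r) b ∷ post)
setAt-concat pre s post r b r<s = begin
  setAt (concat (pre ++ s ∷ post)) (length (concat pre) + suc r) b
    ≡⟨ cong (λ l → setAt l (length (concat pre) + suc r) b) (sym (Lₚ.concat-++ pre (s ∷ post))) ⟩
  setAt (concat pre ++ s ++ concat post) (length (concat pre) + suc r) b
    ≡⟨ setAt-++ʳ (concat pre) (s ++ concat post) r b ⟩
  concat pre ++ setAt (s ++ concat post) (suc r) b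
    ≡⟨ cong (concat pre ++_) (setAt-++ˡ s (concat post) r b r<s) ⟩
  concat pre ++ setAt s (suc r) b ++ concat post
    ≡⟨ Lₚ.concat-++ pre (setAt s (suc r) b ∷ post) ⟩
  concat (pre ++ setAt s (suc r) b ∷ post) ∎
  where open ≡-Reasoning

setAt-segments : (g g′ : ℕ → List Bool) → ∀ {σ c} r b → InRange σ c → r < length (g c) →
                 g′ c ≡ setAt (g c) (suc r) b → (∀ y → y ≢ c → g′ y ≡ g y) →
                 setAt (concat (map g (oneTo σ))) (sum (map (length ∘ g) (oneTo (c ∸ 1))) + suc r) b ≡
                 concat (map g′ (oneTo σ))
setAt-segments g g′ {σ} {suc c} r b (1≤c , c≤σ) r<gc g′c g′y with oneTo-split 1≤c c≤σ
... | rest , split , rest>c = begin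
  setAt (concat (map g (oneTo σ))) (sum (map (length ∘ g) (oneTo c)) + suc r) b
    ≡⟨ cong₂ (λ cs p → setAt (concat (map g cs)) (p + suc r) b) split (sym length-pre) ⟩
  setAt (concat (map g (oneTo c ++ suc c ∷ rest))) (length (concat (map g (oneTo c))) + suc r) b
    ≡⟨ cong (λ l → setAt (concat l) _ b) (Lₚ.map-++ g (oneTo c) (suc c ∷ rest)) ⟩
  setAt (concat (map g (oneTo c) ++ g (suc c) ∷ map g rest)) (length (concat (map g (oneTo c))) + suc r) b
    ≡⟨ setAt-concat (map g (oneTo c)) (g (suc c)) (map g rest) r b r<gc ⟩
  concat (map g (oneTo c) ++ setAt (g (suc c)) (suc r) b ∷ map g rest)
    ≡⟨ cong₂ (λ xs ys → concat (xs ++ ys)) (Lₚ.map-cong-local pre-agree)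
             (cong₂ _∷_ (sym g′c) (Lₚ.map-cong-local rest-agree)) ⟩
  concat (map g′ (oneTo c) ++ g′ (suc c) ∷ map g′ rest)
    ≡⟨ cong concat (sym (Lₚ.map-++ g′ (oneTo c) (suc c ∷ rest))) ⟩
  concat (map g′ (oneTo c ++ suc c ∷ rest))
    ≡⟨ cong (concat ∘ map g′) (sym split) ⟩
  concat (map g′ (oneTo σ)) ∎
  where
  open ≡-Reasoning
  length-pre : length (concat (map g (oneTo c))) ≡ sum (map (length ∘ g) (oneTo c))
  length-pre = trans (length-concat (map g (oneTo c))) (cong sum (sym (Lₚ.map-∘ (oneTo c))))
  pre-agree : All (λ y → g y ≡ g′ y) (oneTo c)
  pre-agree = All.map (λ (_ , y≤c) → sym (g′y _ (ℕₚ.<⇒≢ (s≤s y≤c)))) (oneTo-range c)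
  rest-agree : All (λ y → g y ≡ g′ y) rest
  rest-agree = All.map (λ c<y → sym (g′y _ (ℕₚ.>⇒≢ c<y))) rest>c

write : ℕ × Bool → State → State
write (c , b) (Z , F) = setAt Z (F c) b , (λ x → if x ≡ᵇ c then suc (F x) else F x)

writes : List (ℕ × Bool) → State → State
writes ws st = foldl (λ st′ w → write w st′) st ws

bucket : ℕ → List (ℕ × Bool) → List Bool
bucket c ws = map proj₂ (filter (λ w → proj₁ w ≟ c) ws)

bucket-++ : ∀ c ws ws′ → bucket c (ws ++ ws′) ≡ bucket c ws ++ bucket c ws′
bucket-++ c ws ws′ =
  trans (cong (map proj₂) (Lₚ.filter-++ (λ w → proj₁ w ≟ c) ws ws′)) (Lₚ.map-++ proj₂ (filter (λ w → proj₁ w ≟ c) ws) _)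

bucket-∷ʳ-≡ : ∀ c ws b → bucket c (ws ∷ʳ (c , b)) ≡ bucket c ws ∷ʳ b
bucket-∷ʳ-≡ c ws b =
  trans (bucket-++ c ws _) (cong (λ l → bucket c ws ++ map proj₂ l) (filter-accept (λ w → proj₁ w ≟ c) refl))

bucket-∷ʳ-≢ : ∀ {c y} ws b → y ≢ c → bucket y (ws ∷ʳ (c , b)) ≡ bucket y ws
bucket-∷ʳ-≢ {c} {y} ws b y≢c =
  trans (bucket-++ y ws _)
    (trans (cong (λ l → bucket y ws ++ map proj₂ l) (filter-reject (λ w → proj₁ w ≟ y) (y≢c ∘ sym)))
      (Lₚ.++-identityʳ _))

module Buckets (σ : ℕ) (capacity : ℕ → ℕ) where

  layout : List (ℕ × Bool) → List Bool
  layout ws = false ∷ true ∷ concat (map (λ c → fillTo (capacity c) (bucket c ws)) (oneTo σ))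

  bucketStart : ℕ → ℕ
  bucketStart c = 3 + sum (map capacity (oneTo (c ∸ 1)))

  Fits : List (ℕ × Bool) → Set
  Fits ws = ∀ c → InRange σ c → length (bucket c ws) ≤ capacity c

  Layout : List (ℕ × Bool) → State → Set
  Layout ws (Z , F) = Z ≡ layout ws × (∀ c → InRange σ c → F c ≡ bucketStart c + length (bucket c ws))

  fits-++ˡ : ∀ ws ws′ → Fits (ws ++ ws′) → Fits ws
  fits-++ˡ ws ws′ fits c c∈ =
    ℕₚ.≤-trans (subst (length (bucket c ws) ≤_) (cong length (sym (bucket-++ c ws ws′))) (Lₚ.length-++-≤ˡ (bucket c ws)))
               (fits c c∈)

  write-layout : ∀ ws c b st → InRange σ c → Fits (ws ∷ʳ (c , b)) → Layout ws st →
                 Layout (ws ∷ʳ (c , b)) (write (c , b) st)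
  write-layout ws c b (Z , F) c∈@(1≤c , c≤σ) fits (refl , F≡) = Zpart , Fpart
    where
    seg : List (ℕ × Bool) → ℕ → List Bool
    seg vs y = fillTo (capacity y) (bucket y vs)
    r : ℕ
    r = length (bucket c ws)
    r<cap : r < capacity c
    r<cap = subst (_≤ capacity c) (trans (cong length (bucket-∷ʳ-≡ c ws b)) (length-∷ʳ (bucket c ws) b)) (fits c c∈)
    length-seg : ∀ y → InRange σ y → length (seg ws y) ≡ capacity y
    length-seg y y∈ = length-fillTo (capacity y) (bucket y ws) (fits-++ˡ ws _ fits y y∈)
    below-c : All (InRange σ) (oneTo (c ∸ 1))
    below-c = All.map (λ (1≤y , y≤c) → 1≤y , ℕₚ.≤-trans y≤c (ℕₚ.≤-trans (ℕₚ.m∸n≤m c 1) c≤σ))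
                      (oneTo-range (c ∸ 1))
    offset : sum (map capacity (oneTo (c ∸ 1))) ≡ sum (map (length ∘ seg ws) (oneTo (c ∸ 1)))
    offset = cong sum (Lₚ.map-cong-local (All.map (λ {y} y∈ → sym (length-seg y y∈)) below-c))
    Zpart : setAt (layout ws) (F c) b ≡ layout (ws ∷ʳ (c , b))
    Zpart rewrite F≡ c c∈ =
      cong (λ l → false ∷ true ∷ l)
        (trans (cong (λ p → setAt (concat (map (seg ws) (oneTo σ))) p b)
                     (trans (sym (ℕₚ.+-suc _ r)) (cong (_+ suc r) offset)))
               (setAt-segments (seg ws) (seg (ws ∷ʳ (c , b))) r b c∈
                  (subst (r <_) (sym (length-seg c c∈)) r<cap)
                  (trans (cong (fillTo (capacity c)) (bucket-∷ʳ-≡ c ws b)) (sym (setAt-fillTo (capacity c) (bucket c ws) b r<cap)))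
                  (λ y y≢c → cong (fillTo (capacity y)) (bucket-∷ʳ-≢ ws b y≢c))))
    Fpart : ∀ y → InRange σ y →
            (if y ≡ᵇ c then suc (F y) else F y) ≡ bucketStart y + length (bucket y (ws ∷ʳ (c , b)))
    Fpart y y∈ with y ≟ c
    ... | yes refl rewrite ≡⇒≡ᵇ≡true (refl {x = y}) =
      trans (cong suc (F≡ y y∈))
        (trans (sym (ℕₚ.+-suc (bucketStart y) r))
          (cong (bucketStart y +_) (sym (trans (cong length (bucket-∷ʳ-≡ y ws b)) (length-∷ʳ (bucket y ws) b)))))
    ... | no y≢c rewrite ≢⇒≡ᵇ≡false y≢c =
      trans (F≡ y y∈) (cong (λ l → bucketStart y + length l) (sym (bucket-∷ʳ-≢ ws b y≢c)))

  writes-layout : ∀ ws′ ws st → Layout ws st → All (InRange σ ∘ proj₁) ws′ → Fits (ws ++ ws′) →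
                  Layout (ws ++ ws′) (writes ws′ st)
  writes-layout [] ws st layout-ws _ _ = subst (λ vs → Layout vs st) (sym (Lₚ.++-identityʳ ws)) layout-ws
  writes-layout ((c , b) ∷ ws′) ws st layout-ws (c∈ ∷ ws′∈) fits =
    subst (λ vs → Layout vs (writes ws′ (write (c , b) st))) (Lₚ.++-assoc ws ((c , b) ∷ []) ws′)
      (writes-layout ws′ (ws ∷ʳ (c , b)) (write (c , b) st)
        (write-layout ws c b st c∈ (fits-++ˡ (ws ∷ʳ (c , b)) ws′ fits′) layout-ws) ws′∈ fits′)
    where
    fits′ : Fits ((ws ∷ʳ (c , b)) ++ ws′)
    fits′ = subst Fits (sym (Lₚ.++-assoc ws ((c , b) ∷ []) ws′)) fits

  layout-[] : layout [] ≡ false ∷ true ∷ replicate (sum (map capacity (oneTo σ))) false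
  layout-[] = cong (λ l → false ∷ true ∷ l) (concat-replicate capacity false (oneTo σ))

  layout-full : ∀ ws → (∀ c → InRange σ c → length (bucket c ws) ≡ capacity c) →
                layout ws ≡ false ∷ true ∷ concat (map (λ c → bucket c ws) (oneTo σ))
  layout-full ws full = cong (λ l → false ∷ true ∷ concat l) (Lₚ.map-cong-local (All.map filled (oneTo-range σ)))
    where
    filled : ∀ {c} → InRange σ c → fillTo (capacity c) (bucket c ws) ≡ bucket c ws
    filled {c} c∈ rewrite full c c∈ | ℕₚ.n∸n≡0 (capacity c) = Lₚ.++-identityʳ (bucket c ws)

  writes-buckets : ∀ n ws → n ≡ 2 + sum (map capacity (oneTo σ)) → All (InRange σ ∘ proj₁) ws →
                   (∀ c → InRange σ c → length (bucket c ws) ≡ capacity c) →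
                   proj₁ (writes ws (setAt (setAt (replicate n false) 1 false) 2 true , bucketStart)) ≡
                   false ∷ true ∷ concat (map (λ c → bucket c ws) (oneTo σ))
  writes-buckets n ws refl ws∈ full =
    trans (proj₁ (writes-layout ws [] _ (sym layout-[] , λ c _ → sym (ℕₚ.+-identityʳ _)) ws∈
                    (λ c c∈ → ℕₚ.≤-reflexive (full c c∈))))
          (layout-full ws full)

-- Scanning blocks

IsBlock : List Entry → Set
IsBlock [] = ⊥
IsBlock ((_ , _ , l) ∷ []) = T l
IsBlock ((_ , _ , l) ∷ e ∷ es) = T (not l) × IsBlock (e ∷ es)

blockWrites : Bool → List Entry → List (ℕ × Bool)
blockWrites b blk = map (λ e → entW e , b) (filterᵇ entW⁻ blk)

consume-block : ∀ b blk R st → IsBlock blk → consume b (blk ++ R) st ≡ (R , writes (blockWrites b blk) st)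
consume-block b ((c , true , true) ∷ []) R st _ = refl
consume-block b ((c , false , true) ∷ []) R st _ = refl
consume-block b ((c , true , false) ∷ e ∷ es) R st (_ , blk) = consume-block b (e ∷ es) R (write (c , b) st) blk
consume-block b ((c , false , false) ∷ e ∷ es) R st (_ , blk) = consume-block b (e ∷ es) R st blk

bucket-blockWrites : ∀ c b blk → bucket c (blockWrites b blk) ≡ replicate (ℓ blk c) b
bucket-blockWrites c b [] = refl
bucket-blockWrites c b ((c′ , false , _) ∷ blk) = bucket-blockWrites c b blk
bucket-blockWrites c b ((c′ , true , _) ∷ blk) with c′ ≟ c
... | yes refl rewrite ≡⇒≡ᵇ≡true (refl {x = c′}) = cong (b ∷_) (bucket-blockWrites c b blk)
... | no c′≢c rewrite ≢⇒≡ᵇ≡false c′≢c = bucket-blockWrites c b blk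

ℓ-++ : ∀ blk blk′ c → ℓ (blk ++ blk′) c ≡ ℓ blk c + ℓ blk′ c
ℓ-++ blk blk′ c = trans (cong length (Lₚ.filter-++ _ blk blk′)) (Lₚ.length-++ (filterᵇ _ blk))

ℓ-concat : ∀ c (P : List (List ℕ × List Entry)) → All (λ q → ℓ (proj₂ q) c ≤ 1) P →
           ℓ (concatMap proj₂ P) c ≡ length (filter (λ q → ℓ (proj₂ q) c ≟ 1) P)
ℓ-concat c [] [] = refl
ℓ-concat c ((v , blk) ∷ P) (ℓ≤1 ∷ P≤1) rewrite ℓ-++ blk (concatMap proj₂ P) c with ℓ blk c | ℓ≤1
... | 0 | _ = ℓ-concat c P P≤1
... | 1 | _ = cong suc (ℓ-concat c P P≤1)
... | suc (suc _) | s≤s ()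

module _ {X : Set} (blk : X → List Entry) where

  scanWrites : List (Bool × X) → List (ℕ × Bool)
  scanWrites = concatMap (λ q → blockWrites (proj₁ q) (blk (proj₂ q)))

  outer-interleaving : ∀ M R₀ R₁ st → All (IsBlock ∘ blk ∘ proj₂) M →
                       outer (bits M) (concatMap blk (lefts M) ++ R₀) (concatMap blk (rights M) ++ R₁) st ≡
                       writes (scanWrites M) st
  outer-interleaving [] R₀ R₁ st [] = refl
  outer-interleaving ((false , x) ∷ M) R₀ R₁ st (bx ∷ bM)
    rewrite Lₚ.++-assoc (blk x) (concatMap blk (lefts M)) R₀
          | consume-block false (blk x) (concatMap blk (lefts M) ++ R₀) st bx =
    trans (outer-interleaving M R₀ R₁ _ bM) (sym (Lₚ.foldl-++ _ st (blockWrites false (blk x)) (scanWrites M)))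
  outer-interleaving ((true , x) ∷ M) R₀ R₁ st (bx ∷ bM)
    rewrite Lₚ.++-assoc (blk x) (concatMap blk (rights M)) R₁
          | consume-block true (blk x) (concatMap blk (rights M) ++ R₁) st bx =
    trans (outer-interleaving M R₀ R₁ _ bM) (sym (Lₚ.foldl-++ _ st (blockWrites true (blk x)) (scanWrites M)))

  bucket-scanWrites : ∀ c M → All (λ q → ℓ (blk (proj₂ q)) c ≤ 1) M →
                      bucket c (scanWrites M) ≡ bits (filter (λ q → ℓ (blk (proj₂ q)) c ≟ 1) M)
  bucket-scanWrites c [] [] = refl
  bucket-scanWrites c ((b , x) ∷ M) (ℓ≤1 ∷ M≤1)
    rewrite bucket-++ c (blockWrites b (blk x)) (scanWrites M) | bucket-blockWrites c b (blk x)
    with ℓ (blk x) c | ℓ≤1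
  ... | 0 | _ = bucket-scanWrites c M M≤1
  ... | 1 | _ = cong (b ∷_) (bucket-scanWrites c M M≤1)
  ... | suc (suc _) | s≤s ()

-- The bitvectors Z^(h)

record IsBOSS (σ k : ℕ) (B : List Entry) (vs : List (List ℕ)) : Set where
  field
    blocks         : List (List ℕ × List Entry)
    nodes-blocks   : map proj₁ blocks ≡ vs
    concat-blocks  : concatMap proj₂ blocks ≡ B
    blocks-wf      : All (IsBlock ∘ proj₂) blocks
    marks-in-range : All (λ q → All (InRange σ ∘ entW) (filterᵇ entW⁻ (proj₂ q))) blocks
    marks-≤1       : ∀ c → InRange σ c → All (λ q → ℓ (proj₂ q) c ≤ 1) blocks
    node-length    : All (λ v → length v ≡ k) vs
    key-sorted     : ∀ h → Sorted (key h) vs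
    last-≤σ        : All (λ v → lastSym v ≤ σ) vs
    dollar-fibre   : fibre lastSym 0 vs ≡ replicate k 0 ∷ []
    targets        : ∀ c → InRange σ c →
                     map (target c ∘ proj₁) (filter (λ q → ℓ (proj₂ q) c ≟ 1) blocks) ≡ fibre lastSym c vs

  ℓ-fibre : ∀ c → InRange σ c → ℓ B c ≡ length (fibre lastSym c vs)
  ℓ-fibre c c∈ = begin
    ℓ B c
      ≡⟨ cong (λ B′ → ℓ B′ c) (sym concat-blocks) ⟩
    ℓ (concatMap proj₂ blocks) c
      ≡⟨ ℓ-concat c blocks (marks-≤1 c c∈) ⟩
    length (filter (λ q → ℓ (proj₂ q) c ≟ 1) blocks)
      ≡⟨ sym (Lₚ.length-map (target c ∘ proj₁) (filter (λ q → ℓ (proj₂ q) c ≟ 1) blocks)) ⟩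
    length (map (target c ∘ proj₁) (filter (λ q → ℓ (proj₂ q) c ≟ 1) blocks))
      ≡⟨ cong length (targets c c∈) ⟩
    length (fibre lastSym c vs) ∎
    where open ≡-Reasoning

module Merging {σ k B₀ B₁ vs₀ vs₁} (G₀ : IsBOSS σ k B₀ vs₀) (G₁ : IsBOSS σ k B₁ vs₁) (1≤k : 1 ≤ k) where

  private
    module G₀ = IsBOSS G₀
    module G₁ = IsBOSS G₁

  n : ℕ
  n = length vs₀ + length vs₁

  capacity : ℕ → ℕ
  capacity c = ℓ B₀ c + ℓ B₁ c

  open Buckets σ capacity

  nodes-headed : ∀ {vs} → All (λ v → length v ≡ k) vs → ∀ h → All (HeadedBy (key (suc h)) lastSym) vs
  nodes-headed lens h = All.map (λ {v} len → key-headed h v (subst (1 ≤_) (sym len) 1≤k)) lens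

  merge-by-last : ∀ h → bits (merge (key (suc h)) vs₀ vs₁) ≡
                  false ∷ true ∷
                  concat (map (λ c → bits (merge (key (suc h)) (fibre lastSym c vs₀) (fibre lastSym c vs₁))) (oneTo σ))
  merge-by-last h =
    trans (merge-fibres κ lastSym σ (G₀.key-sorted (suc h)) (G₁.key-sorted (suc h))
             (nodes-headed G₀.node-length h) (nodes-headed G₁.node-length h) G₀.last-≤σ G₁.last-≤σ)
          (cong₂ _++_ dollar (cong (concat ∘ map group) (sym (Lₚ.map-upTo suc σ))))
    where
    κ : List ℕ → List ℕ
    κ = key (suc h)
    group : ℕ → List Bool
    group c = bits (merge κ (fibre lastSym c vs₀) (fibre lastSym c vs₁))
    dollar : group 0 ≡ false ∷ true ∷ []
    dollar rewrite G₀.dollar-fibre | G₁.dollar-fibre = merge-singletons κ (replicate k 0)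

  Z1-merge : Zh σ n B₀ B₁ 1 ≡ bits (merge (key 1) vs₀ vs₁)
  Z1-merge = sym (trans (merge-by-last 0)
                   (cong (λ l → false ∷ true ∷ concat l) (Lₚ.map-cong-local (All.map group-sizes (oneTo-range σ)))))
    where
    keys-one : ∀ c {vs} → All (λ v → length v ≡ k) vs → All (λ v → key 1 v ≡ c ∷ []) (fibre lastSym c vs)
    keys-one c {vs} lens =
      All.zipWith (λ {v} (len , last≡c) → trans (key-one v (subst (1 ≤_) (sym len) 1≤k)) (cong (_∷ []) last≡c))
        (AllP.filter⁺ (λ v → lastSym v ≟ c) lens , AllP.all-filter (λ v → lastSym v ≟ c) vs)
    group-sizes : ∀ {c} → InRange σ c →
                  bits (merge (key 1) (fibre lastSym c vs₀) (fibre lastSym c vs₁)) ≡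
                  replicate (ℓ B₀ c) false ++ replicate (ℓ B₁ c) true
    group-sizes {c} c∈ rewrite G₀.ℓ-fibre c c∈ | G₁.ℓ-fibre c c∈ =
      merge-const (key 1) (keys-one c G₀.node-length) (keys-one c G₁.node-length)

  n≡2+capacities : n ≡ 2 + sum (map capacity (oneTo σ))
  n≡2+capacities = begin
    length vs₀ + length vs₁
      ≡⟨ sym (trans (Lₚ.length-map proj₁ (merge (key 1) vs₀ vs₁)) (length-merge (key 1) vs₀ vs₁)) ⟩
    length (bits (merge (key 1) vs₀ vs₁))
      ≡⟨ cong length (sym Z1-merge) ⟩
    2 + length (concat (map group (oneTo σ)))
      ≡⟨ cong (2 +_) (length-concat (map group (oneTo σ))) ⟩
    2 + sum (map length (map group (oneTo σ)))
      ≡⟨ cong (λ l → 2 + sum l) (sym (Lₚ.map-∘ (oneTo σ))) ⟩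
    2 + sum (map (length ∘ group) (oneTo σ))
      ≡⟨ cong (λ l → 2 + sum l) (Lₚ.map-cong length-group (oneTo σ)) ⟩
    2 + sum (map capacity (oneTo σ)) ∎
    where
    open ≡-Reasoning
    group : ℕ → List Bool
    group c = replicate (ℓ B₀ c) false ++ replicate (ℓ B₁ c) true
    length-group : ∀ c → length (group c) ≡ capacity c
    length-group c = trans (Lₚ.length-++ (replicate (ℓ B₀ c) false))
                           (cong₂ _+_ (Lₚ.length-replicate (ℓ B₀ c)) (Lₚ.length-replicate (ℓ B₁ c)))

  module Step (h : ℕ) (h<k : h < k) where

    M : List (Bool × List ℕ × List Entry)
    M = merge (key h ∘ proj₁) G₀.blocks G₁.blocks

    E : List (ℕ × Bool)
    E = scanWrites proj₂ M

    blocks-sorted : ∀ {B vs} (G : IsBOSS σ k B vs) → Sorted (key h ∘ proj₁) (IsBOSS.blocks G)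
    blocks-sorted G = AllPairsP.map⁻ (subst (Sorted (key h)) (sym (IsBOSS.nodes-blocks G)) (IsBOSS.key-sorted G h))

    marked? : ∀ c → Decidable₁ (λ (q : List ℕ × List Entry) → ℓ (proj₂ q) c ≡ 1)
    marked? c q = ℓ (proj₂ q) c ≟ 1

    marked-keys : ∀ {B vs} (G : IsBOSS σ k B vs) c →
              All (λ q → key (suc h) (target c (proj₁ q)) ≡ c ∷ key h (proj₁ q)) (filter (marked? c) (IsBOSS.blocks G))
    marked-keys G c = AllP.filter⁺ (marked? c)
                    (All.map (λ {q} len → key-target h c (proj₁ q) (subst (h <_) (sym len) h<k))
                      (AllP.map⁻ (subst (All (λ v → length v ≡ k)) (sym (IsBOSS.nodes-blocks G)) (IsBOSS.node-length G))))

    bucket-fibre : ∀ {c} → InRange σ c →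
                   bucket c E ≡ bits (merge (key (suc h)) (fibre lastSym c vs₀) (fibre lastSym c vs₁))
    bucket-fibre {c} c∈ = begin
      bucket c E
        ≡⟨ bucket-scanWrites proj₂ c M (All-merge _ (G₀.marks-≤1 c c∈) (G₁.marks-≤1 c c∈)) ⟩
      bits (filter (marked? c ∘ proj₂) M)
        ≡⟨ cong bits (sym (merge-filter (key h ∘ proj₁) (marked? c) (blocks-sorted G₀) (blocks-sorted G₁))) ⟩
      bits (merge (key h ∘ proj₁) X₀ X₁)
        ≡⟨ cong bits (sym (merge-∷-keys (key h ∘ proj₁) (key (suc h) ∘ target c ∘ proj₁) c
                                         (marked-keys G₀ c) (marked-keys G₁ c))) ⟩
      bits (merge (key (suc h) ∘ target c ∘ proj₁) X₀ X₁)
        ≡⟨ sym (trans (cong bits (merge-map (key (suc h)) (target c ∘ proj₁) X₀ X₁)) (bits-map₂ (target c ∘ proj₁) _)) ⟩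
      bits (merge (key (suc h)) (map (target c ∘ proj₁) X₀) (map (target c ∘ proj₁) X₁))
        ≡⟨ cong₂ (λ Y₀ Y₁ → bits (merge (key (suc h)) Y₀ Y₁)) (G₀.targets c c∈) (G₁.targets c c∈) ⟩
      bits (merge (key (suc h)) (fibre lastSym c vs₀) (fibre lastSym c vs₁)) ∎
      where
      open ≡-Reasoning
      X₀ X₁ : List (List ℕ × List Entry)
      X₀ = filter (marked? c) G₀.blocks
      X₁ = filter (marked? c) G₁.blocks

    bucket-full : ∀ c → InRange σ c → length (bucket c E) ≡ capacity c
    bucket-full c c∈ =
      trans (cong length (bucket-fibre c∈))
        (trans (Lₚ.length-map proj₁ (merge (key (suc h)) (fibre lastSym c vs₀) (fibre lastSym c vs₁)))
          (trans (length-merge (key (suc h)) (fibre lastSym c vs₀) (fibre lastSym c vs₁))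
                 (sym (cong₂ _+_ (G₀.ℓ-fibre c c∈) (G₁.ℓ-fibre c c∈)))))

    writes-in-range : All (InRange σ ∘ proj₁) E
    writes-in-range = AllP.concat⁺ (AllP.map⁺ (All.map AllP.map⁺ (All-merge _ G₀.marks-in-range G₁.marks-in-range)))

    scan-bits : bits (merge (key h) vs₀ vs₁) ≡ bits M
    scan-bits =
      trans (cong₂ (λ X Y → bits (merge (key h) X Y)) (sym G₀.nodes-blocks) (sym G₁.nodes-blocks))
        (trans (cong bits (merge-map (key h) proj₁ G₀.blocks G₁.blocks)) (bits-map₂ proj₁ M))

    concat-blocks-++[] : ∀ {B vs} (G : IsBOSS σ k B vs) → concatMap proj₂ (IsBOSS.blocks G) ++ [] ≡ B
    concat-blocks-++[] G = trans (Lₚ.++-identityʳ _) (IsBOSS.concat-blocks G)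

    zstep-merge : Zstep n B₀ B₁ (bits (merge (key h) vs₀ vs₁)) ≡ bits (merge (key (suc h)) vs₀ vs₁)
    zstep-merge = begin
      Zstep n B₀ B₁ (bits (merge (key h) vs₀ vs₁))
        ≡⟨ cong (Zstep n B₀ B₁) scan-bits ⟩
      proj₁ (outer (bits M) B₀ B₁ st₀)
        ≡⟨ cong₂ (λ X Y → proj₁ (outer (bits M) X Y st₀))
                 (sym (trans (cong (λ P → concatMap proj₂ P ++ []) (lefts-merge _ G₀.blocks G₁.blocks)) (concat-blocks-++[] G₀)))
                 (sym (trans (cong (λ P → concatMap proj₂ P ++ []) (rights-merge _ G₀.blocks G₁.blocks)) (concat-blocks-++[] G₁))) ⟩
      proj₁ (outer (bits M) (concatMap proj₂ (lefts M) ++ []) (concatMap proj₂ (rights M) ++ []) st₀)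
        ≡⟨ cong proj₁ (outer-interleaving proj₂ M [] [] st₀ (All-merge _ G₀.blocks-wf G₁.blocks-wf)) ⟩
      proj₁ (writes E st₀)
        ≡⟨ writes-buckets n E n≡2+capacities writes-in-range bucket-full ⟩
      false ∷ true ∷ concat (map (λ c → bucket c E) (oneTo σ))
        ≡⟨ cong (λ l → false ∷ true ∷ concat l) (Lₚ.map-cong-local (All.map bucket-fibre (oneTo-range σ))) ⟩
      false ∷ true ∷ concat (map (λ c → bits (merge (key (suc h)) (fibre lastSym c vs₀) (fibre lastSym c vs₁))) (oneTo σ))
        ≡⟨ sym (merge-by-last h) ⟩
      bits (merge (key (suc h)) vs₀ vs₁) ∎
      where
      open ≡-Reasoning
      st₀ : State
      st₀ = setAt (setAt (replicate n false) 1 false) 2 true , start B₀ B₁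

  Zh-merge : ∀ h → h < k → Zh σ n B₀ B₁ (suc h) ≡ bits (merge (key (suc h)) vs₀ vs₁)
  Zh-merge zero _ = Z1-merge
  Zh-merge (suc h) h<k = trans (cong (Zstep n B₀ B₁) (Zh-merge h (ℕₚ.<-trans (ℕₚ.n<1+n h) h<k))) (Step.zstep-merge (suc h) h<k)

  Zh-precedes : ∀ h → 1 ≤ h → h ≤ k → (i : Fin (length vs₀)) (j : Fin (length vs₁)) →
                Precedes (Zh σ n B₀ B₁ h) (toℕ i) (toℕ j) ⇔ key h (lookup vs₀ i) ⪯ key h (lookup vs₁ j)
  Zh-precedes (suc h) _ h<k i j rewrite Zh-merge h h<k =
    merge-precedes (key (suc h)) (G₀.key-sorted (suc h)) (G₁.key-sorted (suc h)) i j

-- The BOSS representation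

padded-zeros : ∀ {σ} k s → All (InRange σ) s → ∀ P Q → pad k s ≡ P ++ 0 ∷ Q → All (_≡ 0) P
padded-zeros zero s s∈Σ P Q eq with AllP.++⁻ʳ P (subst (All (InRange _)) eq s∈Σ)
... | (() , _) ∷ _
padded-zeros (suc k) s s∈Σ [] Q eq = []
padded-zeros (suc k) s s∈Σ (x ∷ P) Q eq =
  sym (Lₚ.∷-injectiveˡ eq) ∷ padded-zeros k s s∈Σ P Q (Lₚ.∷-injectiveʳ eq)

module Graph (σ k : ℕ) (S : List (List ℕ)) (overΣ : All (OverΣ σ) S) where

  Occurs : List ℕ → Set
  Occurs w = Any (λ s → Infix _≡_ w (pad k s)) S

  occurs-≤σ : ∀ {w} → Occurs w → All (_≤ σ) w
  occurs-≤σ = All.lookupWith (λ s∈Σ w⊆s → infix-All w⊆s (AllP.++⁺ (AllP.replicate⁺ k z≤n) (All.map proj₂ s∈Σ))) overΣ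

  occurs-last-zero : ∀ {zs} → Occurs (zs ∷ʳ 0) → All (_≡ 0) zs
  occurs-last-zero {zs} = All.lookupWith zeros overΣ
    where
    zeros : ∀ {s} → OverΣ σ s → Infix _≡_ (zs ∷ʳ 0) (pad k s) → All (_≡ 0) zs
    zeros {s} s∈Σ i with infix-split i
    ... | P , Q , eq = AllP.++⁻ʳ P (padded-zeros k s s∈Σ (P ++ zs) Q
                         (trans eq (trans (cong (P ++_) (Lₚ.++-assoc zs (0 ∷ []) Q)) (sym (Lₚ.++-assoc P zs (0 ∷ Q))))))

  predecessor-in : ∀ {w} s → length w ≡ k → Infix _≡_ w (pad k s) → w ≢ replicate k 0 →
                   Σ[ a ∈ ℕ ] Infix _≡_ (a ∷ w) (pad k s)
  predecessor-in {w} s |w|≡k i w≢0ᵏ with infix-split i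
  ... | P , Q , eq with initLast P
  ...   | [] = contradiction (sym (++-prefix (replicate k 0) s w Q (trans (Lₚ.length-replicate k) (sym |w|≡k)) eq)) w≢0ᵏ
  ...   | P′ ∷ʳ′ a =
    a , subst (Infix _≡_ (a ∷ w)) (sym (trans eq (Lₚ.++-assoc P′ (a ∷ []) (w ++ Q)))) (split-infix P′ (a ∷ w) Q)

  occurs-predecessor : ∀ {w S′} → length w ≡ k → Any (λ s → Infix _≡_ w (pad k s)) S′ → w ≢ replicate k 0 →
                       Σ[ a ∈ ℕ ] Any (λ s → Infix _≡_ (a ∷ w) (pad k s)) S′
  occurs-predecessor |w|≡k (here i) w≢0ᵏ = map₂ here (predecessor-in _ |w|≡k i w≢0ᵏ)
  occurs-predecessor |w|≡k (there o) w≢0ᵏ = map₂ there (occurs-predecessor |w|≡k o w≢0ᵏ)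

  edge⇒occurs : ∀ u c → T (edgeᵇ k S u c) → Occurs (u ∷ʳ c)
  edge⇒occurs u c e = Any.map toWitness (any⁻ _ S e)

  occurs⇒edge : ∀ u c → Occurs (u ∷ʳ c) → T (edgeᵇ k S u c)
  occurs⇒edge u c o = any⁺ _ (Any.map fromWitness o)

labelBlock : (ℕ → Bool) → List ℕ → List Entry
labelBlock w [] = ($ , false , true) ∷ []
labelBlock w (c ∷ cs) = markLast (map (λ c′ → c′ , w c′) (c ∷ cs))

block-labelBlock : ∀ σ k S E v → block σ k S E v ≡ labelBlock (minBit k S E v) (outLabels σ k S v)
block-labelBlock σ k S E v with outLabels σ k S v
... | [] = refl
... | _ ∷ _ = refl

markLast-IsBlock : ∀ x xs → IsBlock (markLast (x ∷ xs))
markLast-IsBlock x [] = tt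
markLast-IsBlock x (y ∷ []) = tt , tt
markLast-IsBlock x (y ∷ z ∷ xs) = tt , markLast-IsBlock y (z ∷ xs)

labelBlock-IsBlock : ∀ (w : ℕ → Bool) cs → IsBlock (labelBlock w cs)
labelBlock-IsBlock w [] = tt
labelBlock-IsBlock w (c ∷ cs) = markLast-IsBlock (c , w c) (map (λ c′ → c′ , w c′) cs)

markLast-All : ∀ {P : ℕ → Set} {ys} → All (P ∘ proj₁) ys → All (P ∘ entW) (markLast ys)
markLast-All [] = []
markLast-All (p ∷ []) = p ∷ []
markLast-All (p ∷ ps@(_ ∷ _)) = p ∷ markLast-All ps

labelBlock-marks : ∀ {P : ℕ → Set} (w : ℕ → Bool) {cs} → All P cs → All (P ∘ entW) (filterᵇ entW⁻ (labelBlock w cs))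
labelBlock-marks w [] = []
labelBlock-marks w ps@(_ ∷ _) = AllP.filter⁺ (T? ∘ entW⁻) (markLast-All (AllP.map⁺ ps))

ℓ-markLast : ∀ (w : ℕ → Bool) c₁ cs c → ℓ (markLast (map (λ c′ → c′ , w c′) (c₁ ∷ cs))) c ≡
                           length (filterᵇ (λ c′ → w c′ ∧ (c′ ≡ᵇ c)) (c₁ ∷ cs))
ℓ-markLast w c₁ [] c with w c₁ ∧ (c₁ ≡ᵇ c)
... | true = refl
... | false = refl
ℓ-markLast w c₁ (c₂ ∷ cs) c with w c₁ ∧ (c₁ ≡ᵇ c) | ℓ-markLast w c₂ cs c
... | true | rec = cong suc rec
... | false | rec = rec

ℓ-labelBlock : ∀ (w : ℕ → Bool) cs c → ℓ (labelBlock w cs) c ≡ length (filterᵇ (λ c′ → w c′ ∧ (c′ ≡ᵇ c)) cs)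
ℓ-labelBlock w [] c = refl
ℓ-labelBlock w (c₁ ∷ cs) c = ℓ-markLast w c₁ cs c

module Blocks (σ k : ℕ) (S : List (List ℕ)) where

  marked : ℕ → List (List ℕ) → List ℕ → Bool
  marked c E v = edgeᵇ k S v c ∧ minBit k S E v c

  ℓ-block : ∀ E v {c} → InRange σ c → ℓ (block σ k S E v) c ≡ (if marked c E v then 1 else 0)
  ℓ-block E v {c} c∈ = begin
    ℓ (block σ k S E v) c
      ≡⟨ cong (λ blk → ℓ blk c) (block-labelBlock σ k S E v) ⟩
    ℓ (labelBlock w (filterᵇ e (oneTo σ))) c
      ≡⟨ ℓ-labelBlock w (filterᵇ e (oneTo σ)) c ⟩
    length (filterᵇ (λ x → w x ∧ (x ≡ᵇ c)) (filterᵇ e (oneTo σ)))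
      ≡⟨ cong length (filterᵇ-filterᵇ (λ x → w x ∧ (x ≡ᵇ c)) e (oneTo σ)) ⟩
    length (filterᵇ p (oneTo σ))
      ≡⟨ length-filterᵇ-oneTo p c∈ p≢c ⟩
    (if p c then 1 else 0)
      ≡⟨ cong (λ b → if b then 1 else 0) p-c ⟩
    (if marked c E v then 1 else 0) ∎
    where
    open ≡-Reasoning
    w e p : ℕ → Bool
    w = minBit k S E v
    e = edgeᵇ k S v
    p x = e x ∧ (w x ∧ (x ≡ᵇ c))
    p≢c : ∀ x → x ≢ c → p x ≡ false
    p≢c x x≢c rewrite ≢⇒≡ᵇ≡false x≢c | ∧-zeroʳ (w x) = ∧-zeroʳ (e x)
    p-c : p c ≡ marked c E v
    p-c rewrite ≡⇒≡ᵇ≡true (refl {x = c}) | ∧-identityʳ (w c) = refl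

  block-IsBlock : ∀ E v → IsBlock (block σ k S E v)
  block-IsBlock E v = subst IsBlock (sym (block-labelBlock σ k S E v)) (labelBlock-IsBlock (minBit k S E v) (outLabels σ k S v))

  block-marks : ∀ E v → All (InRange σ ∘ entW) (filterᵇ entW⁻ (block σ k S E v))
  block-marks E v = subst (λ blk → All (InRange σ ∘ entW) (filterᵇ entW⁻ blk)) (sym (block-labelBlock σ k S E v))
                      (labelBlock-marks (minBit k S E v) (AllP.filter⁺ (T? ∘ edgeᵇ k S v) (oneTo-range σ)))

  NoEdgeInto : ℕ → List ℕ → List (List ℕ) → Set
  NoEdgeInto c X E = All (λ u → ¬ (drop 1 u ≡ X × T (edgeᵇ k S u c))) E

  minBit-sound : ∀ E v c → T (minBit k S E v c) → NoEdgeInto c (drop 1 v) E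
  minBit-sound E v c t =
    All.map (λ ¬q (d , e) → ¬q (Equivalence.from T-∧ (fromWitness d , e))) (AllP.¬Any⇒All¬ E (T-not⁻ t ∘ any⁺ _))

  minBit-complete : ∀ E v c → NoEdgeInto c (drop 1 v) E → T (minBit k S E v c)
  minBit-complete E v c none =
    T-not⁺ (λ t → AllP.All¬⇒¬Any none (Any.map (λ q → map₁ toWitness (Equivalence.to T-∧ q)) (any⁻ _ E t)))

  markedTargets : ℕ → List (List ℕ) → List (List ℕ) → List (List ℕ)
  markedTargets c E [] = []
  markedTargets c E (v ∷ xs) =
    if marked c E v then target c v ∷ markedTargets c (E ∷ʳ v) xs else markedTargets c (E ∷ʳ v) xs

  MinimalSource : ℕ → List (List ℕ) → List (List ℕ) → List ℕ → Set
  MinimalSource c E xs z = Σ[ u ∈ List ℕ ] u ∈ xs × T (edgeᵇ k S u c) × z ≡ target c u × NoEdgeInto c (drop 1 u) E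

  minimal-skip : ∀ {c E xs v z} → MinimalSource c (E ∷ʳ v) xs z → MinimalSource c E (v ∷ xs) z
  minimal-skip {E = E} (u , u∈ , e , z≡ , none) = u , there u∈ , e , z≡ , AllP.++⁻ˡ E none

  marked-edge : ∀ c E v → marked c E v ≡ true → T (edgeᵇ k S v c) × T (minBit k S E v c)
  marked-edge c E v eq = Equivalence.to T-∧ (Equivalence.from T-≡ eq)

  markedTargets-sound : ∀ c E xs {z} → z ∈ markedTargets c E xs → MinimalSource c E xs z
  markedTargets-sound c E (v ∷ xs) z∈ with marked c E v in eq
  markedTargets-sound c E (v ∷ xs) (here refl) | true =
    v , here refl , proj₁ (marked-edge c E v eq) , refl , minBit-sound E v c (proj₂ (marked-edge c E v eq))
  markedTargets-sound c E (v ∷ xs) (there z∈) | true = minimal-skip (markedTargets-sound c (E ∷ʳ v) xs z∈)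
  markedTargets-sound c E (v ∷ xs) z∈ | false = minimal-skip (markedTargets-sound c (E ∷ʳ v) xs z∈)

  markedTargets-sorted : ∀ c E {xs} → AllPairs _≺colex_ xs → All (λ v → length v ≡ k) xs →
                         AllPairs _≺colex_ (markedTargets c E xs)
  markedTargets-sorted c E {[]} [] [] = []
  markedTargets-sorted c E {v ∷ xs} (v≺xs ∷ sxs) (|v| ∷ |xs|) with marked c E v in eq
  ... | true = All.tabulate first ∷ markedTargets-sorted c (E ∷ʳ v) sxs |xs|
    where
    first : ∀ {z} → z ∈ markedTargets c (E ∷ʳ v) xs → target c v ≺colex z
    first z∈ with markedTargets-sound c (E ∷ʳ v) xs z∈
    ... | u , u∈ , _ , refl , none =
      target-colex c v u (trans |v| (sym (All.lookup |xs| u∈)))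
        (λ d → All.lookup (AllP.++⁻ʳ E none) (here refl) (d , proj₁ (marked-edge c E v eq)))
        (All.lookup v≺xs u∈)
  ... | false = markedTargets-sorted c (E ∷ʳ v) sxs |xs|

  markedTargets-complete : ∀ c E xs X u → u ∈ xs → drop 1 u ≡ X → T (edgeᵇ k S u c) → NoEdgeInto c X E →
                           (X ∷ʳ c) ∈ markedTargets c E xs
  markedTargets-complete c E (v ∷ xs) X u u∈ du eu none with Lₚ.≡-dec _≟_ (drop 1 v) X
  ... | yes refl with edgeᵇ k S v c in ev
  ...   | true rewrite Equivalence.to T-≡ (minBit-complete E v c none) = here refl
  ...   | false = markedTargets-complete c (E ∷ʳ v) xs X u (∈-tail u∈ (λ { refl → subst T ev eu })) du eu
                    (AllP.++⁺ none ((λ (_ , e) → subst T ev e) ∷ []))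
  markedTargets-complete c E (v ∷ xs) X u u∈ du eu none | no dv≢X with marked c E v
  ... | true = there (markedTargets-complete c (E ∷ʳ v) xs X u (∈-tail u∈ (λ { refl → dv≢X du })) du eu
                        (AllP.++⁺ none ((dv≢X ∘ proj₁) ∷ [])))
  ... | false = markedTargets-complete c (E ∷ʳ v) xs X u (∈-tail u∈ (λ { refl → dv≢X du })) du eu
                  (AllP.++⁺ none ((dv≢X ∘ proj₁) ∷ []))

module Construction (σ k : ℕ) (S : List (List ℕ)) (S≢[] : S ≢ []) (overΣ : All (OverΣ σ) S)
                    (vs : List (List ℕ)) (order : NodeOrder k S vs) (1≤k : 1 ≤ k) where

  open Graph σ k S overΣ
  open Blocks σ k S

  node⇒∈ : ∀ {v} → IsNode k S v → v ∈ vs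
  node⇒∈ {v} = Equivalence.from (proj₁ order v)

  ∈⇒node : ∀ {v} → v ∈ vs → IsNode k S v
  ∈⇒node {v} = Equivalence.to (proj₁ order v)

  node-length : All (λ v → length v ≡ k) vs
  node-length = All.tabulate (proj₁ ∘ ∈⇒node)

  colex-sorted : AllPairs _≺colex_ vs
  colex-sorted = Linked⇒AllPairs ≺-trans (proj₂ order)

  last-≤σ : All (λ v → lastSym v ≤ σ) vs
  last-≤σ = All.tabulate (λ {v} v∈ → lastSym-All v (occurs-≤σ (proj₂ (∈⇒node v∈))) z≤n)

  zero-node : ∀ {v} → IsNode k S v → lastSym v ≡ 0 → v ≡ replicate k 0
  zero-node {v} (|v| , occ) last≡0 with initLast v
  ... | [] = contradiction |v| (ℕₚ.<⇒≢ 1≤k)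
  ... | zs ∷ʳ′ x with trans (sym (lastSym-∷ʳ zs x)) last≡0
  ...   | refl = trans (All-≡-replicate (zs ∷ʳ 0) (AllP.++⁺ (occurs-last-zero occ) (refl ∷ [])))
                       (cong (λ m → replicate m 0) |v|)

  dollar-occurs : ∀ {S′} → S′ ≢ [] → Any (λ s → Infix _≡_ (replicate k 0) (pad k s)) S′
  dollar-occurs {[]} S′≢[] = contradiction refl S′≢[]
  dollar-occurs {s ∷ _} _ = here (split-infix [] (replicate k 0) s)

  lastSym-dollar : lastSym (replicate k 0) ≡ 0
  lastSym-dollar = lastSym-All {P = _≡ 0} (replicate k 0) (AllP.replicate⁺ k refl) refl

  dollar-fibre : fibre lastSym 0 vs ≡ replicate k 0 ∷ []
  dollar-fibre = sorted-unique ≺-trans ≺-irrefl (AllPairsP.filter⁺ (λ v → lastSym v ≟ 0) colex-sorted) ([] ∷ []) ⊆ ⊇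
    where
    ⊆ : ∀ {z} → z ∈ fibre lastSym 0 vs → z ∈ replicate k 0 ∷ []
    ⊆ z∈ with ∈-filter⁻ (λ v → lastSym v ≟ 0) z∈
    ... | z∈vs , last≡0 = here (zero-node (∈⇒node z∈vs) last≡0)
    ⊇ : ∀ {z} → z ∈ replicate k 0 ∷ [] → z ∈ fibre lastSym 0 vs
    ⊇ (here refl) = ∈-filter⁺ (λ v → lastSym v ≟ 0) (node⇒∈ (Lₚ.length-replicate k , dollar-occurs S≢[])) lastSym-dollar

  target-node : ∀ {u c} → u ∈ vs → T (edgeᵇ k S u c) → IsNode k S (target c u)
  target-node {[]} u∈ _ = contradiction (proj₁ (∈⇒node u∈)) (ℕₚ.<⇒≢ 1≤k)
  target-node {a ∷ u} {c} u∈ e = trans (length-∷ʳ u c) (proj₁ (∈⇒node u∈)) , Any.map infix-tail (edge⇒occurs (a ∷ u) c e)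

  source-node : ∀ {z c} → z ∈ vs → lastSym z ≡ c → 1 ≤ c →
                Σ[ u ∈ List ℕ ] u ∈ vs × drop 1 u ∷ʳ c ≡ z × T (edgeᵇ k S u c)
  source-node {z} {c} z∈ last≡c 1≤c with initLast z | ∈⇒node z∈
  ... | [] | (|z| , _) = contradiction |z| (ℕₚ.<⇒≢ 1≤k)
  ... | zs ∷ʳ′ x | (|z| , occ)
    with refl ← trans (sym (lastSym-∷ʳ zs x)) last≡c
       | a , occ′ ← occurs-predecessor |z| occ
                      (λ z≡0ᵏ → ℕₚ.<⇒≢ 1≤c (trans (sym (trans (cong lastSym z≡0ᵏ) lastSym-dollar)) last≡c)) =
    a ∷ zs , node⇒∈ (trans (sym (length-∷ʳ zs x)) |z| , Any.map infix-++ˡ occ′) , refl , occurs⇒edge (a ∷ zs) x occ′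

  blocksFrom : List (List ℕ) → List (List ℕ) → List (List ℕ × List Entry)
  blocksFrom E [] = []
  blocksFrom E (v ∷ xs) = (v , block σ k S E v) ∷ blocksFrom (E ∷ʳ v) xs

  blocksFrom-nodes : ∀ E xs → map proj₁ (blocksFrom E xs) ≡ xs
  blocksFrom-nodes E [] = refl
  blocksFrom-nodes E (v ∷ xs) = cong (v ∷_) (blocksFrom-nodes (E ∷ʳ v) xs)

  blocksFrom-concat : ∀ E xs → concatMap proj₂ (blocksFrom E xs) ≡ bossGo σ k S E xs
  blocksFrom-concat E [] = refl
  blocksFrom-concat E (v ∷ xs) = cong (block σ k S E v ++_) (blocksFrom-concat (E ∷ʳ v) xs)

  blocksFrom-All : ∀ {P : List ℕ × List Entry → Set} → (∀ E v → P (v , block σ k S E v)) → ∀ E xs → All P (blocksFrom E xs)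
  blocksFrom-All p E [] = []
  blocksFrom-All p E (v ∷ xs) = p E v ∷ blocksFrom-All p (E ∷ʳ v) xs

  blocksFrom-targets : ∀ {c} → InRange σ c → ∀ E xs →
                       map (target c ∘ proj₁) (filter (λ q → ℓ (proj₂ q) c ≟ 1) (blocksFrom E xs)) ≡ markedTargets c E xs
  blocksFrom-targets c∈ E [] = refl
  blocksFrom-targets {c} c∈ E (v ∷ xs) with marked c E v | ℓ-block E v c∈
  ... | true | ℓ≡1 rewrite ℓ≡1 = cong (target c v ∷_) (blocksFrom-targets c∈ (E ∷ʳ v) xs)
  ... | false | ℓ≡0 rewrite ℓ≡0 = blocksFrom-targets c∈ (E ∷ʳ v) xs

  markedTargets-fibre : ∀ {c} → InRange σ c → markedTargets c [] vs ≡ fibre lastSym c vs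
  markedTargets-fibre {c} (1≤c , _) =
    sorted-unique ≺-trans ≺-irrefl (markedTargets-sorted c [] colex-sorted node-length)
      (AllPairsP.filter⁺ (λ v → lastSym v ≟ c) colex-sorted) ⊆ ⊇
    where
    ⊆ : ∀ {z} → z ∈ markedTargets c [] vs → z ∈ fibre lastSym c vs
    ⊆ z∈ with markedTargets-sound c [] vs z∈
    ... | u , u∈ , e , refl , _ = ∈-filter⁺ (λ v → lastSym v ≟ c) (node⇒∈ (target-node u∈ e)) (lastSym-∷ʳ (drop 1 u) c)
    ⊇ : ∀ {z} → z ∈ fibre lastSym c vs → z ∈ markedTargets c [] vs
    ⊇ z∈ with ∈-filter⁻ (λ v → lastSym v ≟ c) z∈
    ... | z∈vs , last≡c with source-node z∈vs last≡c 1≤c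
    ...   | u , u∈ , refl , e = markedTargets-complete c [] vs (drop 1 u) u u∈ refl e []

  isBOSS : IsBOSS σ k (BOSS σ k S vs) vs
  isBOSS = record
    { blocks         = blocksFrom [] vs
    ; nodes-blocks   = blocksFrom-nodes [] vs
    ; concat-blocks  = blocksFrom-concat [] vs
    ; blocks-wf      = blocksFrom-All block-IsBlock [] vs
    ; marks-in-range = blocksFrom-All block-marks [] vs
    ; marks-≤1       = λ c c∈ → blocksFrom-All (λ E v → ≤1 (marked c E v) (ℓ-block E v c∈)) [] vs
    ; node-length    = node-length
    ; key-sorted     = λ h → AllPairs.map (take-⪯ h) colex-sorted
    ; last-≤σ        = last-≤σ
    ; dollar-fibre   = dollar-fibre
    ; targets        = λ c c∈ → trans (blocksFrom-targets c∈ [] vs) (markedTargets-fibre c∈)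
    }
    where
    ≤1 : ∀ b {m} → m ≡ (if b then 1 else 0) → m ≤ 1
    ≤1 true refl = ℕₚ.≤-refl
    ≤1 false refl = z≤n

lemma2 : (σ k : ℕ) (S₀ S₁ : List (List ℕ)) →
         S₀ ≢ [] → S₁ ≢ [] →
         All (OverΣ σ) S₀ → All (OverΣ σ) S₁ →
         (vs₀ vs₁ : List (List ℕ)) →
         NodeOrder k S₀ vs₀ → NodeOrder k S₁ vs₁ →
         (h : ℕ) → 2 ≤ h → h ≤ k →
         (i : Fin (length vs₀)) (j : Fin (length vs₁)) →
         Precedes (Zh σ (length vs₀ + length vs₁) (BOSS σ k S₀ vs₀) (BOSS σ k S₁ vs₁) h) (toℕ i) (toℕ j)
           ⇔ (take h (reverse (lookup vs₀ i)) ⪯ take h (reverse (lookup vs₁ j)))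
lemma2 σ k S₀ S₁ S₀≢[] S₁≢[] overΣ₀ overΣ₁ vs₀ vs₁ order₀ order₁ h 2≤h h≤k =
  Merging.Zh-precedes (Construction.isBOSS σ k S₀ S₀≢[] overΣ₀ vs₀ order₀ 1≤k)
                      (Construction.isBOSS σ k S₁ S₁≢[] overΣ₁ vs₁ order₁ 1≤k) 1≤k h 1≤h h≤k
  where
  1≤h : 1 ≤ h
  1≤h = ℕₚ.≤-trans (ℕₚ.n≤1+n 1) 2≤h
  1≤k : 1 ≤ k
  1≤k = ℕₚ.≤-trans 1≤h h≤k
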